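{- Let $G=(g_0,\dots,g_k)$ be a smooth sequence of positive integers with $\gcd(g_0,\dots,g_k)=1$ and $c$ values $(c_1,\dots,c_k)$; set $c_0:=1$. Let $\mathit{NR}=\mathbb{N}_0\setminus\langle G\rangle$, $S_m(G)=\sum_{n\in\mathit{NR}}n^m$, $T_m(G)=\sum_{n\in\mathit{NR}}(-1)^nn^m$, $I_G=\{i\in\{0,\dots,k\}: g_i\text{ even}\}$, and $Q=\frac12\bigl(1-g_0^2+\sum_{i=1}^k(c_i^2-1)g_i^2\bigr)$. (1) If $g_0$ is odd, then \[T_0(G)=\tfrac12\Bigl(1-\prod_{i\in I_G}c_i\Bigr),\quad T_1(G)=-\tfrac14\Bigl(1+(2S_0(G)-1)\prod_{i\in I_G}c_i\Bigr),\] \[T_2(G)=-\Bigl(\frac{3S_2(G)}{2S_0(G)-1}-\frac1{12}\sum_{i\in I_G}g_i^2(c_i^2-1)\Bigr)\prod_{i\in I_G}c_i.\] (2) If all $g_i$ are odd, then $T_0(G)=0$, $T_1(G)=-S_0(G)/2$, and \[T_2(G)=-\frac{S_0(G)(S_0(G)-1)}{2}-\frac{Q}{4}=-\frac{3S_2(G)}{2S_0(G)-1}=-2T_1(G)^2-T_1(G)-\frac{Q}{4}.\]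
   Context: For a sequence $G=(g_0,\dots,g_k)$ of positive integers, $d_i=\gcd(g_0,\dots,g_i)$ and $c_i=d_{i-1}/d_i$ for $1\le i\le k$ are the $c$ values; $G$ is smooth if $c_ig_i\in\langle g_0,\dots,g_{i-1}\rangle$ for $1\le i\le k$, where $\langle\cdot\rangle$ denotes the set of finite non-negative integer linear combinations. -}

module Defs where

open import Data.Nat as ℕ using (ℕ; zero; suc; _≤_; _<_)
open import Data.Nat.GCD using (gcd)
open import Data.Nat.Divisibility using (_∣?_)
open import Data.Integer as ℤ using (ℤ; +_; -1ℤ)
open import Data.Rational as ℚ using (ℚ; 0ℚ; 1ℚ)
open import Data.List using (List; map; upTo; foldr; length)
open import Data.Nat.ListAction using (sum; product)
open import Data.List.Membership.Propositional using (_∈_)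
open import Data.List.Relation.Unary.Unique.Propositional using (Unique)
open import Data.Product using (Σ; _×_)
open import Data.Bool using (if_then_else_)
open import Relation.Nullary using (¬_; does)
open import Relation.Binary.PropositionalEquality using (_≡_)

-- A sequence G = (g_0,…,g_k) is represented by k together with g : ℕ → ℕ;
-- only the values g 0, …, g k are relevant.

sumℕ : ℕ → (ℕ → ℕ) → ℕ
sumℕ j f = sum (map f (upTo j))

sumℚ : List ℚ → ℚ
sumℚ = foldr ℚ._+_ 0ℚ

d : (ℕ → ℕ) → ℕ → ℕ
d g zero    = g zero
d g (suc i) = gcd (d g i) (g (suc i))

-- natural-number division (the divisor is always positive where used)
divℕ : ℕ → ℕ → ℕ
divℕ m zero    = 0
divℕ m (suc n) = m ℕ./ suc n

c : (ℕ → ℕ) → ℕ → ℕ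
c g zero    = 1
c g (suc i) = divℕ (d g i) (d g (suc i))

InSG : (ℕ → ℕ) → ℕ → ℕ → Set
InSG g j n = Σ (ℕ → ℕ) λ a → sumℕ j (λ i → a i ℕ.* g i) ≡ n

Smooth : ℕ → (ℕ → ℕ) → Set
Smooth k g = ∀ i → 1 ≤ i → i ≤ k → InSG g i (c g i ℕ.* g i)

IsNR : ℕ → (ℕ → ℕ) → List ℕ → Set
IsNR k g NR = Unique NR × (∀ n → (n ∈ NR → ¬ InSG g (suc k) n) × (¬ InSG g (suc k) n → n ∈ NR))

toℚ : ℤ → ℚ
toℚ z = z ℚ./ 1

ofℕ : ℕ → ℚ
ofℕ n = toℚ (+ n)

S : List ℕ → ℕ → ℚ
S NR m = sumℚ (map (λ n → ofℕ (n ℕ.^ m)) NR)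

T : List ℕ → ℕ → ℚ
T NR m = sumℚ (map (λ n → toℚ (-1ℤ ℤ.^ n ℤ.* + (n ℕ.^ m))) NR)

prodIG : ℕ → (ℕ → ℕ) → ℚ
prodIG k g = ofℕ (product (map (λ i → if does (2 ∣? g i) then c g i else 1) (upTo (suc k))))

sumIG : ℕ → (ℕ → ℕ) → ℚ
sumIG k g = sumℚ (map (λ i → if does (2 ∣? g i)
                                then ofℕ (g i ℕ.* g i) ℚ.* (ofℕ (c g i ℕ.* c g i) ℚ.- 1ℚ)
                                else 0ℚ) (upTo (suc k)))

Qval : ℕ → (ℕ → ℕ) → ℚ
Qval k g = ℚ.½ ℚ.* (1ℚ ℚ.- ofℕ (g 0 ℕ.* g 0)
             ℚ.+ sumℚ (map (λ j → (ofℕ (c g (suc j) ℕ.* c g (suc j)) ℚ.- 1ℚ)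
                                    ℚ.* ofℕ (g (suc j) ℕ.* g (suc j))) (upTo k)))

-- x / (2s − 1) for s : ℕ (2s − 1 is odd, hence nonzero)
divOdd : ℤ → ℕ → ℚ
divOdd x zero    = ℚ.- toℚ x
divOdd x (suc t) = x ℚ./ suc (2 ℕ.* t)

threeS2over : List ℕ → ℚ
threeS2over NR = divOdd (+ (3 ℕ.* sum (map (λ n → n ℕ.^ 2) NR))) (length NR)

module Submission where

-- Smoothness gives every element of ⟨G⟩ a unique normal form
--   n = a₁g₁ + … + a_k g_k + j g₀   with digits 0 ≤ aᵢ < cᵢ,
-- so the Apéry set of g₀ is the set of digit values W(a) = Σ aᵢgᵢ.
-- Comparing NR with NR + g₀ then gives, for every f : ℕ → ℤ, the telescoping identity
--   Σ_{n ∈ NR} (f(n + g₀) − f(n)) = Σ_{digits a} f(W(a)) − Σ_{r < g₀} f(r).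
-- For f(n) = σ(n) nʲ (j ≤ 3, σ ≡ 1 or σ(n) = (−1)ⁿ) the digit sum factors over the
-- positions i into sums over arithmetic progressions {a gᵢ : a < cᵢ}, so it is
-- explicit in the cᵢ and gᵢ.  Expanding (n + g₀)ʲ turns the telescoping identities
-- into linear equations for the integers s_j = S_j and t_j = T_j; eliminating
-- the auxiliary quantities yields the corollary over ℤ, which is then
-- transported to ℚ.

module FiniteSums where
  open import Data.Nat as ℕ using (ℕ; zero; suc; z≤n; s≤s)
  import Data.Nat.Properties as ℕP
  open import Data.Integer using (ℤ; 0ℤ; _+_; _*_; _-_)
  import Data.Integer.Properties as ℤP
  open import Data.Integer.Tactic.RingSolver using (solve-∀)
  open import Relation.Binary.PropositionalEquality

  sumℤ : ℕ → (ℕ → ℤ) → ℤ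
  sumℤ zero    f = 0ℤ
  sumℤ (suc n) f = f 0 + sumℤ n (λ i → f (suc i))

  sumℤ-cong : ∀ n {f h : ℕ → ℤ} → (∀ i → i ℕ.< n → f i ≡ h i) → sumℤ n f ≡ sumℤ n h
  sumℤ-cong zero    eq = refl
  sumℤ-cong (suc n) eq = cong₂ _+_ (eq 0 (s≤s z≤n)) (sumℤ-cong n (λ i i<n → eq (suc i) (s≤s i<n)))

  sumℤ-ext : ∀ n {f h : ℕ → ℤ} → (∀ i → f i ≡ h i) → sumℤ n f ≡ sumℤ n h
  sumℤ-ext n eq = sumℤ-cong n (λ i _ → eq i)

  sumℤ-+ : ∀ n (f h : ℕ → ℤ) → sumℤ n (λ i → f i + h i) ≡ sumℤ n f + sumℤ n h
  sumℤ-+ zero    f h = refl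
  sumℤ-+ (suc n) f h = trans (cong (f 0 + h 0 +_) (sumℤ-+ n _ _)) (interchange (f 0) (h 0) _ _)
    where
    interchange : ∀ a b c d → (a + b) + (c + d) ≡ (a + c) + (b + d)
    interchange = solve-∀

  sumℤ-- : ∀ n (f h : ℕ → ℤ) → sumℤ n (λ i → f i - h i) ≡ sumℤ n f - sumℤ n h
  sumℤ-- zero    f h = refl
  sumℤ-- (suc n) f h = trans (cong (f 0 - h 0 +_) (sumℤ-- n _ _)) (interchange (f 0) (h 0) _ _)
    where
    interchange : ∀ a b c d → (a - b) + (c - d) ≡ (a + c) - (b + d)
    interchange = solve-∀

  sumℤ-* : ∀ n (k : ℤ) (f : ℕ → ℤ) → sumℤ n (λ i → k * f i) ≡ k * sumℤ n f
  sumℤ-* zero    k f = sym (ℤP.*-zeroʳ k)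
  sumℤ-* (suc n) k f = trans (cong (k * f 0 +_) (sumℤ-* n k _)) (sym (ℤP.*-distribˡ-+ k (f 0) _))

  sumℤ-0 : ∀ n → sumℤ n (λ _ → 0ℤ) ≡ 0ℤ
  sumℤ-0 zero    = refl
  sumℤ-0 (suc n) = trans (ℤP.+-identityˡ _) (sumℤ-0 n)

  sumℤ-last : ∀ n (f : ℕ → ℤ) → sumℤ (suc n) f ≡ sumℤ n f + f n
  sumℤ-last zero    f = ℤP.+-comm (f 0) 0ℤ
  sumℤ-last (suc n) f = trans (cong (f 0 +_) (sumℤ-last n _)) (sym (ℤP.+-assoc (f 0) _ _))

  sumℤ-split : ∀ m n (f : ℕ → ℤ) → sumℤ (m ℕ.+ n) f ≡ sumℤ m f + sumℤ n (λ i → f (m ℕ.+ i))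
  sumℤ-split zero    n f = sym (ℤP.+-identityˡ _)
  sumℤ-split (suc m) n f = trans (cong (f 0 +_) (sumℤ-split m n _)) (sym (ℤP.+-assoc (f 0) _ _))

  -- Sum over digit tuples: for digit bounds cc and weights gg,
  --   digitSum cc gg i F = Σ_{a₁ < cc 1} … Σ_{aᵢ < cc i} F (a₁·gg 1 + … + aᵢ·gg i).
  digitSum : (cc gg : ℕ → ℕ) → ℕ → (ℕ → ℤ) → ℤ
  digitSum cc gg zero    F = F 0
  digitSum cc gg (suc i) F = digitSum cc gg i (λ x → sumℤ (cc (suc i)) (λ a → F (x ℕ.+ a ℕ.* gg (suc i))))

  module _ (cc gg : ℕ → ℕ) where
    digitSum-ext : ∀ i {F G : ℕ → ℤ} → (∀ w → F w ≡ G w) → digitSum cc gg i F ≡ digitSum cc gg i G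
    digitSum-ext zero    eq = eq 0
    digitSum-ext (suc i) eq = digitSum-ext i (λ x → sumℤ-ext (cc (suc i)) (λ a → eq _))

    digitSum-+ : ∀ i (F G : ℕ → ℤ) → digitSum cc gg i (λ w → F w + G w) ≡ digitSum cc gg i F + digitSum cc gg i G
    digitSum-+ zero    F G = refl
    digitSum-+ (suc i) F G = trans (digitSum-ext i (λ x → sumℤ-+ (cc (suc i)) _ _)) (digitSum-+ i _ _)

    digitSum-* : ∀ i (k : ℤ) (F : ℕ → ℤ) → digitSum cc gg i (λ w → k * F w) ≡ k * digitSum cc gg i F
    digitSum-* zero    k F = refl
    digitSum-* (suc i) k F = trans (digitSum-ext i (λ x → sumℤ-* (cc (suc i)) k _)) (digitSum-* i k _)

    digitSum-0 : ∀ i → digitSum cc gg i (λ _ → 0ℤ) ≡ 0ℤ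
    digitSum-0 zero    = refl
    digitSum-0 (suc i) = trans (digitSum-ext i (λ x → sumℤ-0 (cc (suc i)))) (digitSum-0 i)

    digitSum-sumℤ : ∀ i M (h : ℕ → ℕ → ℤ) →
                    digitSum cc gg i (λ w → sumℤ M (λ m → h m w)) ≡ sumℤ M (λ m → digitSum cc gg i (h m))
    digitSum-sumℤ i zero    h = digitSum-0 i
    digitSum-sumℤ i (suc M) h = trans (digitSum-+ i (h 0) _) (cong (digitSum cc gg i (h 0) +_) (digitSum-sumℤ i M (λ m → h (suc m))))

    maxDigitValue : ℕ → ℕ
    maxDigitValue zero    = 0
    maxDigitValue (suc i) = maxDigitValue i ℕ.+ (cc (suc i) ℕ.∸ 1) ℕ.* gg (suc i)

    digitSum-cong : ∀ i {F G : ℕ → ℤ} → (∀ w → w ℕ.≤ maxDigitValue i → F w ≡ G w) → digitSum cc gg i F ≡ digitSum cc gg i G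
    digitSum-cong zero    eq = eq 0 z≤n
    digitSum-cong (suc i) eq = digitSum-cong i (λ x x≤ → sumℤ-cong (cc (suc i)) (λ a a< → eq _
        (ℕP.+-mono-≤ x≤ (ℕP.*-monoˡ-≤ (gg (suc i)) (ℕP.∸-monoˡ-≤ 1 a<)))))

module NormalForm where
  open import Defs
  open import Data.Nat as ℕ using (ℕ; zero; suc; _+_; _*_; _∸_; _≤_; _<_; z≤n; s≤s; NonZero)
  open import Data.Nat.Properties
  open import Data.Nat.Divisibility
  open import Data.Nat.DivMod
  open import Data.Nat.GCD
  open import Data.Nat.Coprimality using (Coprime; coprime-/gcd; coprime-divisor)
  open import Data.List using ([_]; _++_; map; upTo)
  open import Data.List.Properties using (map-++; upTo-∷ʳ)
  open import Data.Nat.ListAction using (sum)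
  open import Data.Nat.ListAction.Properties using (sum-++)
  open import Data.Nat.Tactic.RingSolver using (solve-∀)
  open import Relation.Nullary using (yes; no; Dec)
  open import Data.Empty using (⊥-elim)
  open import Relation.Binary.PropositionalEquality hiding ([_])
  open import Data.Product using (Σ; _×_; _,_; proj₁; proj₂)
  open import Data.Sum using (inj₁; inj₂)

  sumℕ-last : ∀ j f → sumℕ (suc j) f ≡ sumℕ j f + f j
  sumℕ-last j f = begin
    sum (map f (upTo (suc j)))         ≡⟨ cong (λ xs → sum (map f xs)) (sym (upTo-∷ʳ j)) ⟩
    sum (map f (upTo j ++ [ j ]))     ≡⟨ cong sum (map-++ f (upTo j) [ j ]) ⟩
    sum (map f (upTo j) ++ [ f j ])   ≡⟨ sum-++ (map f (upTo j)) [ f j ] ⟩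
    sumℕ j f + (f j + 0)               ≡⟨ cong (sumℕ j f +_) (+-identityʳ (f j)) ⟩
    sumℕ j f + f j                     ∎
    where open ≡-Reasoning

  update : (ℕ → ℕ) → ℕ → ℕ → ℕ → ℕ
  update a p r l with l ℕ.≟ p
  ... | yes _ = r
  ... | no _  = a l

  update-here : ∀ a p r → update a p r p ≡ r
  update-here a p r with p ℕ.≟ p
  ... | yes _ = refl
  ... | no ne = ⊥-elim (ne refl)

  update-there : ∀ a p r l → l ≢ p → update a p r l ≡ a l
  update-there a p r l ne with l ℕ.≟ p
  ... | yes e = ⊥-elim (ne e)
  ... | no _  = refl

  divℕ-*-cancel : ∀ m n → n ∣ m → 0 < n → divℕ m n * n ≡ m
  divℕ-*-cancel m (suc n) n∣m _ = m/n*n≡m n∣m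

  divℕ≡/ : ∀ m n .{{_ : NonZero n}} → divℕ m n ≡ m ℕ./ n
  divℕ≡/ m (suc n) = refl

  module SmoothSequence (g : ℕ → ℕ) (k : ℕ) (pos : ∀ i → i ≤ k → 0 < g i) (sm : Smooth k g) where

    digitValue : ℕ → (ℕ → ℕ) → ℕ
    digitValue zero    a = 0
    digitValue (suc i) a = digitValue i a + a (suc i) * g (suc i)

    Digits : ℕ → (ℕ → ℕ) → Set
    Digits i a = ∀ l → 1 ≤ l → l ≤ i → a l < c g l

    Digits-pred : ∀ i a → Digits (suc i) a → Digits i a
    Digits-pred i a v l 1≤l l≤i = v l 1≤l (m≤n⇒m≤1+n l≤i)

    digitValue-ext : ∀ i {a b} → (∀ l → 1 ≤ l → l ≤ i → a l ≡ b l) → digitValue i a ≡ digitValue i b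
    digitValue-ext zero    eq = refl
    digitValue-ext (suc i) eq = cong₂ _+_ (digitValue-ext i (λ l 1≤l l≤i → eq l 1≤l (m≤n⇒m≤1+n l≤i)))
                                          (cong (_* g (suc i)) (eq (suc i) (s≤s z≤n) ≤-refl))

    digitValue-update : ∀ i a r → digitValue i (update a (suc i) r) ≡ digitValue i a
    digitValue-update i a r = digitValue-ext i (λ l _ l≤i → update-there a (suc i) r l
                                (λ l≡ → <-irrefl refl (≤-trans (s≤s (≤-reflexive (sym l≡))) (s≤s l≤i))))

    Digits-update : ∀ i a r → Digits i a → r < c g (suc i) → Digits (suc i) (update a (suc i) r)
    Digits-update i a r va r< l 1≤l l≤si = bound (l ℕ.≟ suc i)
      where
      bound : Dec (l ≡ suc i) → update a (suc i) r l < c g l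
      bound (yes refl) = subst (_< c g (suc i)) (sym (update-here a (suc i) r)) r<
      bound (no ne)    = subst (_< c g l) (sym (update-there a (suc i) r l ne)) (va l 1≤l (ℕ.≤-pred (≤∧≢⇒< l≤si ne)))

    combination-split : ∀ i b → sumℕ (suc i) (λ l → b l * g l) ≡ b 0 * g 0 + digitValue i b
    combination-split zero    b = refl
    combination-split (suc i) b =
      trans (sumℕ-last (suc i) (λ l → b l * g l))
            (trans (cong (_+ b (suc i) * g (suc i)) (combination-split i b)) (+-assoc (b 0 * g 0) _ _))

    combination-+* : ∀ n (b e : ℕ → ℕ) q →
      sumℕ n (λ l → (b l + q * e l) * g l) ≡ sumℕ n (λ l → b l * g l) + q * sumℕ n (λ l → e l * g l)
    combination-+* zero    b e q = sym (*-zeroʳ q)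
    combination-+* (suc n) b e q = begin
        sumℕ (suc n) (λ l → (b l + q * e l) * g l)
          ≡⟨ sumℕ-last n (λ l → (b l + q * e l) * g l) ⟩
        sumℕ n (λ l → (b l + q * e l) * g l) + (b n + q * e n) * g n
          ≡⟨ cong (_+ (b n + q * e n) * g n) (combination-+* n b e q) ⟩
        B + q * E + (b n + q * e n) * g n
          ≡⟨ regroup B E (b n) (e n) q (g n) ⟩
        (B + b n * g n) + q * (E + e n * g n)
          ≡⟨ sym (cong₂ (λ x y → x + q * y) (sumℕ-last n (λ l → b l * g l)) (sumℕ-last n (λ l → e l * g l))) ⟩
        sumℕ (suc n) (λ l → b l * g l) + q * sumℕ (suc n) (λ l → e l * g l) ∎
      where
      open ≡-Reasoning
      B = sumℕ n (λ l → b l * g l)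
      E = sumℕ n (λ l → e l * g l)
      regroup : ∀ B E x y q G → B + q * E + (x + q * y) * G ≡ (B + x * G) + q * (E + y * G)
      regroup = solve-∀

    g₀>0 : 0 < g 0
    g₀>0 = pos 0 z≤n

    instance
      g₀-nonZero : NonZero (g 0)
      g₀-nonZero = ℕ.>-nonZero g₀>0

    normalForm∈⟨G⟩ : ∀ a j → InSG g (suc k) (digitValue k a + j * g 0)
    normalForm∈⟨G⟩ a j = b , trans (combination-split k b) (trans (cong (j * g 0 +_) (digitValue-ext k same)) (+-comm (j * g 0) _))
      where
      b : ℕ → ℕ
      b zero    = j
      b (suc l) = a (suc l)
      same : ∀ l → 1 ≤ l → l ≤ k → b l ≡ a l
      same (suc l) _ _ = refl

    d-pos : ∀ i → i ≤ k → 0 < d g i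
    d-pos zero    _    = g₀>0
    d-pos (suc i) si≤k = n≢0⇒n>0 (gcd[m,n]≢0 (d g i) (g (suc i)) (inj₁ (n>0⇒n≢0 (d-pos i (≤-trans (n≤1+n i) si≤k)))))

    d-step : ∀ i → d g (suc i) ∣ d g i
    d-step i = gcd[m,n]∣m (d g i) (g (suc i))

    d-antitone : ∀ {l i} → l ≤ i → d g i ∣ d g l
    d-antitone {l} {i} l≤i = subst (λ z → d g z ∣ d g l) (m∸n+n≡m l≤i) (d∣d (i ∸ l))
      where
      d∣d : ∀ t → d g (t + l) ∣ d g l
      d∣d zero    = ∣-refl
      d∣d (suc t) = ∣-trans (d-step (t + l)) (d∣d t)

    d∣g : ∀ l → d g l ∣ g l
    d∣g zero    = ∣-refl
    d∣g (suc l) = gcd[m,n]∣n (d g l) (g (suc l))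

    d∣g₀ : ∀ i → d g i ∣ g 0
    d∣g₀ i = d-antitone {0} {i} z≤n

    d∣digitValue : ∀ i a → d g i ∣ digitValue i a
    d∣digitValue zero    a = _ ∣0
    d∣digitValue (suc i) a = ∣m∣n⇒∣m+n (∣-trans (d-step i) (d∣digitValue i a)) (∣n⇒∣m*n (a (suc i)) (d∣g (suc i)))

    c*d : ∀ i → suc i ≤ k → c g (suc i) * d g (suc i) ≡ d g i
    c*d i si≤k = divℕ-*-cancel (d g i) (d g (suc i)) (d-step i) (d-pos (suc i) si≤k)

    c-pos : ∀ i → suc i ≤ k → 0 < c g (suc i)
    c-pos i si≤k with c g (suc i) in eq
    ... | zero  = ⊥-elim (n>0⇒n≢0 (d-pos i (≤-trans (n≤1+n i) si≤k)) (trans (sym (c*d i si≤k)) (cong (_* d g (suc i)) eq)))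
    ... | suc _ = s≤s z≤n

    -- c_{i+1} is the order of g_{i+1} modulo d_i: no smaller positive multiple is divisible by d_i.
    order-minimal : ∀ i → suc i ≤ k → ∀ t → t < c g (suc i) → d g i ∣ t * g (suc i) → t ≡ 0
    order-minimal i si≤k zero     _   _  = refl
    order-minimal i si≤k (suc t') t<C d∣ = ⊥-elim (<-irrefl refl (<-≤-trans t<C (∣⇒≤ C∣t)))
      where
      e = d g (suc i)
      C = c g (suc i)
      G = g (suc i)
      instance
        e-nonZero : NonZero e
        e-nonZero = ℕ.>-nonZero (d-pos (suc i) si≤k)
      h = G ℕ./ e
      reassoc : ∀ t e h → t * (e * h) ≡ t * h * e
      reassoc = solve-∀
      C-coprime : Coprime C h
      C-coprime = subst (λ z → Coprime z h) (sym (divℕ≡/ (d g i) e)) (coprime-/gcd (d g i) G)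
      C∣th : C ∣ suc t' * h
      C∣th = *-cancelʳ-∣ e (subst₂ _∣_ (sym (c*d i si≤k))
               (trans (cong (suc t' *_) (sym (m*[n/m]≡n (d∣g (suc i))))) (reassoc (suc t') e h)) d∣)
      C∣t : C ∣ suc t'
      C∣t = coprime-divisor C-coprime (subst (C ∣_) (*-comm (suc t') h) C∣th)

    last-digit-≤-unique : ∀ i → suc i ≤ k → ∀ X Y a a' → d g i ∣ X → d g i ∣ Y → a' < c g (suc i) →
                          X + a * g (suc i) ≡ Y + a' * g (suc i) → a ≤ a' → a ≡ a'
    last-digit-≤-unique i si≤k X Y a a' dX dY a'< eq a≤a' = sym (trans (sym (m∸n+n≡m a≤a')) (cong (_+ a) t≡0))
      where
      t = a' ∸ a
      G = g (suc i)
      shift : ∀ Y t a G → Y + (t + a) * G ≡ (Y + t * G) + a * G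
      shift = solve-∀
      X≡ : X ≡ Y + t * G
      X≡ = +-cancelʳ-≡ (a * G) X (Y + t * G)
             (trans eq (trans (cong (λ z → Y + z * G) (sym (m∸n+n≡m a≤a'))) (shift Y t a G)))
      t≡0 : t ≡ 0
      t≡0 = order-minimal i si≤k t (≤-<-trans (m∸n≤m a' a) a'<) (∣m+n∣m⇒∣n (subst (d g i ∣_) X≡ dX) dY)

    last-digit-unique : ∀ i → suc i ≤ k → ∀ X Y a a' → d g i ∣ X → d g i ∣ Y → a < c g (suc i) → a' < c g (suc i) →
                        X + a * g (suc i) ≡ Y + a' * g (suc i) → a ≡ a'
    last-digit-unique i si≤k X Y a a' dX dY a< a'< eq with ≤-total a a'
    ... | inj₁ a≤a' = last-digit-≤-unique i si≤k X Y a a' dX dY a'< eq a≤a'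
    ... | inj₂ a'≤a = sym (last-digit-≤-unique i si≤k Y X a' a dY dX a< (sym eq) a'≤a)

    -- Existence of normal forms: reduce the last coefficient modulo c_{i+1}, using
    -- smoothness to rewrite the multiple q·c_{i+1}·g_{i+1} in terms of g₀,…,gᵢ.
    normalForm : ∀ i → i ≤ k → ∀ b → Σ (ℕ → ℕ) λ a → Σ ℕ λ j →
                 Digits i a × sumℕ (suc i) (λ l → b l * g l) ≡ digitValue i a + j * g 0
    normalForm zero    _    b = (λ _ → 0) , b 0 , (λ l 1≤l l≤0 → ⊥-elim (<-irrefl refl (≤-trans 1≤l l≤0))) , +-comm (b 0 * g 0) 0
    normalForm (suc i) si≤k b = a' , j , Digits-update i a r va (m%n<n (b (suc i)) C) , eqn
      where
      C = c g (suc i)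
      G = g (suc i)
      instance
        C-nonZero : NonZero C
        C-nonZero = ℕ.>-nonZero (c-pos i si≤k)
      q = b (suc i) ℕ./ C
      r = b (suc i) ℕ.% C
      e = proj₁ (sm (suc i) (s≤s z≤n) si≤k)
      CG≡ : sumℕ (suc i) (λ l → e l * g l) ≡ C * G
      CG≡ = proj₂ (sm (suc i) (s≤s z≤n) si≤k)
      b' : ℕ → ℕ
      b' l = b l + q * e l
      IH = normalForm i (≤-trans (n≤1+n i) si≤k) b'
      a = proj₁ IH
      j = proj₁ (proj₂ IH)
      va = proj₁ (proj₂ (proj₂ IH))
      a' = update a (suc i) r
      B = sumℕ (suc i) (λ l → b l * g l)
      absorb : ∀ B x q C G → B + (x + q * C) * G ≡ (B + q * (C * G)) + x * G
      absorb = solve-∀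
      swap : ∀ x y z → x + y + z ≡ x + z + y
      swap = solve-∀
      eqn : sumℕ (suc (suc i)) (λ l → b l * g l) ≡ digitValue (suc i) a' + j * g 0
      eqn = begin
        sumℕ (suc (suc i)) (λ l → b l * g l)    ≡⟨ sumℕ-last (suc i) (λ l → b l * g l) ⟩
        B + b (suc i) * G                        ≡⟨ cong (λ z → B + z * G) (m≡m%n+[m/n]*n (b (suc i)) C) ⟩
        B + (r + q * C) * G                      ≡⟨ absorb B r q C G ⟩
        (B + q * (C * G)) + r * G                ≡⟨ cong (λ z → B + q * z + r * G) (sym CG≡) ⟩
        (B + q * sumℕ (suc i) (λ l → e l * g l)) + r * G  ≡⟨ cong (_+ r * G) (sym (combination-+* (suc i) b e q)) ⟩
        sumℕ (suc i) (λ l → b' l * g l) + r * G  ≡⟨ cong (_+ r * G) (proj₂ (proj₂ (proj₂ IH))) ⟩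
        digitValue i a + j * g 0 + r * G         ≡⟨ cong₂ (λ x y → x + j * g 0 + y * G) (sym (digitValue-update i a r)) (sym (update-here a (suc i) r)) ⟩
        digitValue i a' + j * g 0 + a' (suc i) * G  ≡⟨ swap (digitValue i a') (j * g 0) (a' (suc i) * G) ⟩
        digitValue (suc i) a' + j * g 0 ∎
        where open ≡-Reasoning

    normalForm-unique : ∀ i → i ≤ k → ∀ a b j j' → Digits i a → Digits i b →
                        digitValue i a + j * g 0 ≡ digitValue i b + j' * g 0 → j ≡ j'
    normalForm-unique zero    _    a b j j' va vb eq = *-cancelʳ-≡ j j' (g 0) eq
    normalForm-unique (suc i) si≤k a b j j' va vb eq =
      normalForm-unique i (≤-trans (n≤1+n i) si≤k) a b j j' (Digits-pred i a va) (Digits-pred i b vb) X≡Y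
      where
      G = g (suc i)
      X = digitValue i a + j * g 0
      Y = digitValue i b + j' * g 0
      swap : ∀ w x y → w + x + y ≡ (w + y) + x
      swap = solve-∀
      eq' : X + a (suc i) * G ≡ Y + b (suc i) * G
      eq' = trans (sym (swap (digitValue i a) _ _)) (trans eq (swap (digitValue i b) _ _))
      same-digit : a (suc i) ≡ b (suc i)
      same-digit = last-digit-unique i si≤k X Y _ _
                     (∣m∣n⇒∣m+n (d∣digitValue i a) (∣n⇒∣m*n j (d∣g₀ i)))
                     (∣m∣n⇒∣m+n (d∣digitValue i b) (∣n⇒∣m*n j' (d∣g₀ i)))
                     (va (suc i) (s≤s z≤n) ≤-refl) (vb (suc i) (s≤s z≤n) ≤-refl) eq'
      X≡Y : X ≡ Y
      X≡Y = +-cancelʳ-≡ (b (suc i) * G) X Y (subst (λ z → X + z * G ≡ Y + b (suc i) * G) same-digit eq')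

module Counting where
  open import Defs
  open NormalForm
  open FiniteSums
  open import Data.Nat as ℕ using (ℕ; zero; suc; _+_; _*_; _∸_; _≤_; _<_; z≤n; s≤s)
  open import Data.Nat.Properties
  open import Data.Integer using (ℤ; 0ℤ; 1ℤ)
  open import Relation.Nullary using (¬_; yes; no; Dec)
  open import Data.Empty using (⊥-elim)
  open import Relation.Binary.PropositionalEquality
  open import Data.Product using (Σ; _×_; _,_)
  open import Data.Sum using (_⊎_; inj₁; inj₂)
  open import Function using (_∘_)

  indicator : ∀ {P : Set} → Dec P → ℤ
  indicator (yes _) = 1ℤ
  indicator (no _)  = 0ℤ

  δ : ℕ → ℕ → ℤ
  δ m w = indicator (w ℕ.≟ m)

  δ-cases : ∀ m w → (w ≡ m × δ m w ≡ 1ℤ) ⊎ (w ≢ m × δ m w ≡ 0ℤ)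
  δ-cases m w with w ℕ.≟ m
  ... | yes e = inj₁ (e , refl)
  ... | no ne = inj₂ (ne , refl)

  δ-sym : ∀ m w → δ m w ≡ δ w m
  δ-sym m w with δ-cases m w | δ-cases w m
  ... | inj₁ (_ , p)  | inj₁ (_ , q)  = trans p (sym q)
  ... | inj₂ (_ , p)  | inj₂ (_ , q)  = trans p (sym q)
  ... | inj₁ (e , _)  | inj₂ (ne , _) = ⊥-elim (ne (sym e))
  ... | inj₂ (ne , _) | inj₁ (e , _)  = ⊥-elim (ne (sym e))

  δ-shift : ∀ m s x → s ≤ m → δ m (x + s) ≡ δ (m ∸ s) x
  δ-shift m s x s≤m with δ-cases m (x + s) | δ-cases (m ∸ s) x
  ... | inj₁ (_ , p)  | inj₁ (_ , q)  = trans p (sym q)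
  ... | inj₂ (_ , p)  | inj₂ (_ , q)  = trans p (sym q)
  ... | inj₁ (e , _)  | inj₂ (ne , _) = ⊥-elim (ne (trans (sym (m+n∸n≡m x s)) (cong (_∸ s) e)))
  ... | inj₂ (ne , _) | inj₁ (e , _)  = ⊥-elim (ne (trans (cong (_+ s) e) (m∸n+n≡m s≤m)))

  δ-beyond : ∀ m s x → m < s → δ m (x + s) ≡ 0ℤ
  δ-beyond m s x m<s with δ-cases m (x + s)
  ... | inj₂ (_ , p) = p
  ... | inj₁ (e , _) = ⊥-elim (<-irrefl refl (<-≤-trans m<s (subst (s ≤_) e (m≤n+m s x))))

  sum-of-exclusive-indicators :
    ∀ n (e : ℕ → ℤ) (P : ℕ → Set) → (∀ a → a < n → (e a ≡ 0ℤ × ¬ P a) ⊎ (e a ≡ 1ℤ × P a)) →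
    (∀ a a' → a < n → a' < n → P a → P a' → a ≡ a') →
    (sumℤ n e ≡ 0ℤ × (∀ a → a < n → ¬ P a)) ⊎ (sumℤ n e ≡ 1ℤ × Σ ℕ λ a → a < n × P a)
  sum-of-exclusive-indicators zero    e P h u = inj₁ (refl , λ a ())
  sum-of-exclusive-indicators (suc n) e P h u
    with h 0 (s≤s z≤n)
       | sum-of-exclusive-indicators n (e ∘ suc) (P ∘ suc) (λ a a< → h (suc a) (s≤s a<))
           (λ a a' a< a'< p p' → suc-injective (u (suc a) (suc a') (s≤s a<) (s≤s a'<) p p'))
  ... | inj₁ (e0 , ¬p0) | inj₁ (r0 , ¬p)           = inj₁ (cong₂ Data.Integer._+_ e0 r0 , λ { zero _ → ¬p0 ; (suc a) (s≤s a<) → ¬p a a< })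
  ... | inj₁ (e0 , _)   | inj₂ (r1 , a , a< , pa)  = inj₂ (cong₂ Data.Integer._+_ e0 r1 , suc a , s≤s a< , pa)
  ... | inj₂ (e1 , p0)  | inj₁ (r0 , _)            = inj₂ (cong₂ Data.Integer._+_ e1 r0 , 0 , s≤s z≤n , p0)
  ... | inj₂ (_ , p0)   | inj₂ (_ , a , a< , pa)   = ⊥-elim (0≢1+n (u 0 (suc a) (s≤s z≤n) (s≤s a<) p0 pa))

  module Representations (g : ℕ → ℕ) (k : ℕ) (pos : ∀ i → i ≤ k → 0 < g i) (sm : Smooth k g) where
    open SmoothSequence g k pos sm

    representations : ℕ → ℕ → ℤ
    representations i m = digitSum (c g) g i (δ m)

    NoRepresentation OneRepresentation : ℕ → ℕ → Set
    NoRepresentation  i m = representations i m ≡ 0ℤ × (∀ a → Digits i a → digitValue i a ≢ m)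
    OneRepresentation i m = representations i m ≡ 1ℤ × Σ (ℕ → ℕ) λ a → Digits i a × digitValue i a ≡ m

    representations-0-or-1 : ∀ i → i ≤ k → ∀ m → NoRepresentation i m ⊎ OneRepresentation i m
    representations-0-or-1 zero _ m with δ-cases m 0
    ... | inj₁ (e , p)  = inj₂ (p , (λ _ → 0) , (λ l 1≤l l≤0 → ⊥-elim (<-irrefl refl (≤-trans 1≤l l≤0))) , e)
    ... | inj₂ (ne , p) = inj₁ (p , λ a _ → ne)
    representations-0-or-1 (suc i) si≤k m = combine (sum-of-exclusive-indicators C e P per-digit exclusive)
      where
      i≤k = ≤-trans (n≤1+n i) si≤k
      C = c g (suc i)
      G = g (suc i)
      e : ℕ → ℤ
      e a = digitSum (c g) g i (λ x → δ m (x + a * G))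
      P : ℕ → Set
      P a = Σ (ℕ → ℕ) λ b → Digits i b × digitValue i b + a * G ≡ m
      per-digit : ∀ a → a < C → (e a ≡ 0ℤ × ¬ P a) ⊎ (e a ≡ 1ℤ × P a)
      per-digit a a< with a * G ℕ.≤? m
      ... | no aG≰m = inj₁ (trans (digitSum-ext (c g) g i (λ x → δ-beyond m (a * G) x (≰⇒> aG≰m))) (digitSum-0 (c g) g i) ,
                            λ { (b , vb , eqb) → aG≰m (subst (a * G ≤_) eqb (m≤n+m (a * G) (digitValue i b))) })
      ... | yes aG≤m with representations-0-or-1 i i≤k (m ∸ a * G)
      ...   | inj₁ (z , none)          = inj₁ (trans (digitSum-ext (c g) g i (λ x → δ-shift m (a * G) x aG≤m)) z ,
                                               λ { (b , vb , eqb) → none b vb (trans (sym (m+n∸n≡m (digitValue i b) (a * G))) (cong (_∸ a * G) eqb)) })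
      ...   | inj₂ (o , b , vb , eqb)  = inj₂ (trans (digitSum-ext (c g) g i (λ x → δ-shift m (a * G) x aG≤m)) o ,
                                               b , vb , trans (cong (_+ a * G) eqb) (m∸n+n≡m aG≤m))
      split : representations (suc i) m ≡ sumℤ C e
      split = digitSum-sumℤ (c g) g i C (λ a x → δ m (x + a * G))
      exclusive : ∀ a a' → a < C → a' < C → P a → P a' → a ≡ a'
      exclusive a a' a< a'< (b , _ , eb) (b' , _ , eb') =
        last-digit-unique i si≤k (digitValue i b) (digitValue i b') a a' (d∣digitValue i b) (d∣digitValue i b') a< a'< (trans eb (sym eb'))
      combine : (sumℤ C e ≡ 0ℤ × (∀ a → a < C → ¬ P a)) ⊎ (sumℤ C e ≡ 1ℤ × Σ ℕ λ a → a < C × P a) →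
                NoRepresentation (suc i) m ⊎ OneRepresentation (suc i) m
      combine (inj₁ (z , none)) =
        inj₁ (trans split z , λ a va eqa → none (a (suc i)) (va (suc i) (s≤s z≤n) ≤-refl) (a , Digits-pred i a va , eqa))
      combine (inj₂ (o , a , a< , b , vb , eqb)) =
        inj₂ (trans split o , update b (suc i) a , Digits-update i b a vb a< ,
              trans (cong₂ _+_ (digitValue-update i b a) (cong (_* g (suc i)) (update-here b (suc i) a))) eqb)

-- Pointwise this is the identity  [m − g₀ ∈ NR] − [m ∈ NR] = [m is a digit value] − [m < g₀],
-- a restatement of the fact that the digit values form the Apéry set of g₀.
module Telescoping where
  open import Defs
  open NormalForm
  open FiniteSums
  open Counting
  open import Data.Nat as ℕ using (ℕ; zero; suc; _+_; _*_; _∸_; _≤_; _<_; s≤s)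
  open import Data.Nat.Properties
  open import Data.Integer as ℤ using (ℤ; 0ℤ; 1ℤ)
  import Data.Integer.Properties as ℤP
  open import Data.Integer.Tactic.RingSolver using (solve-∀)
  import Data.Nat.Tactic.RingSolver as ℕSolver
  open import Data.List using (List; []; _∷_)
  open import Data.List.Extrema.Nat using (max; xs≤max)
  open import Data.List.Membership.Propositional using (_∈_)
  open import Data.List.Membership.DecPropositional ℕ._≟_ using (_∈?_)
  open import Data.List.Relation.Unary.Any using (here; there)
  open import Data.List.Relation.Unary.All as All using (All)
  open import Data.List.Relation.Unary.Unique.Propositional using (Unique)
  open import Data.List.Relation.Unary.AllPairs using ([]; _∷_)
  open import Relation.Nullary using (¬_; yes; no; Dec)
  open import Data.Empty using (⊥-elim)
  open import Relation.Binary.PropositionalEquality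
  open import Data.Product using (_×_; _,_; proj₁; proj₂)
  open import Data.Sum using (_⊎_; inj₁; inj₂)

  listSum : List ℕ → (ℕ → ℤ) → ℤ
  listSum []       h = 0ℤ
  listSum (x ∷ xs) h = h x ℤ.+ listSum xs h

  member : List ℕ → ℕ → ℤ
  member xs n = indicator (n ∈? xs)

  member-outside : ∀ xs n → ¬ (n ∈ xs) → member xs n ≡ 0ℤ
  member-outside xs n n∉ with n ∈? xs
  ... | yes n∈ = ⊥-elim (n∉ n∈)
  ... | no _   = refl

  sumℤ-δ-outside : ∀ M x (h : ℕ → ℤ) → M ≤ x → sumℤ M (λ n → δ x n ℤ.* h n) ≡ 0ℤ
  sumℤ-δ-outside M x h M≤x = trans (sumℤ-cong M vanish) (sumℤ-0 M)
    where
    vanish : ∀ n → n < M → δ x n ℤ.* h n ≡ 0ℤ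
    vanish n n<M with δ-cases x n
    ... | inj₁ (e , _) = ⊥-elim (<-irrefl e (<-≤-trans n<M M≤x))
    ... | inj₂ (_ , p) = cong (ℤ._* h n) p

  sumℤ-δ : ∀ M x (h : ℕ → ℤ) → x < M → sumℤ M (λ n → δ x n ℤ.* h n) ≡ h x
  sumℤ-δ (suc M) x h x<sM with δ-cases x M
  ... | inj₁ (e , p)  = trans (sumℤ-last M _) (trans (cong₂ ℤ._+_ (sumℤ-δ-outside M x h (≤-reflexive e)) (cong₂ ℤ._*_ p (cong h e)))
                          (trans (ℤP.+-identityˡ _) (ℤP.*-identityˡ _)))
  ... | inj₂ (ne , p) = trans (sumℤ-last M _) (trans (cong₂ ℤ._+_ (sumℤ-δ M x h (≤∧≢⇒< (ℕ.≤-pred x<sM) (λ e → ne (sym e)))) (cong (ℤ._* h M) p))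
                          (trans (cong (λ z → h x ℤ.+ z) (ℤP.*-zeroˡ (h M))) (ℤP.+-identityʳ _)))

  member-∷ : ∀ x xs n → ¬ (x ∈ xs) → member (x ∷ xs) n ≡ δ x n ℤ.+ member xs n
  member-∷ x xs n x∉ = go (n ∈? (x ∷ xs)) (δ-cases x n) (n ∈? xs)
    where
    go : (d1 : Dec (n ∈ (x ∷ xs))) → ((n ≡ x × δ x n ≡ 1ℤ) ⊎ (n ≢ x × δ x n ≡ 0ℤ)) → (d2 : Dec (n ∈ xs)) →
         indicator d1 ≡ δ x n ℤ.+ indicator d2
    go (yes _)         (inj₁ (e , _))   (yes n∈) = ⊥-elim (x∉ (subst (_∈ xs) e n∈))
    go (yes _)         (inj₁ (_ , δ1))  (no _)   = sym (cong (ℤ._+ 0ℤ) δ1)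
    go (yes (here e))  (inj₂ (ne , _))  _        = ⊥-elim (ne e)
    go (yes (there _)) (inj₂ (_ , δ0))  (yes _)  = sym (cong (ℤ._+ 1ℤ) δ0)
    go (yes (there q)) (inj₂ _)         (no nq)  = ⊥-elim (nq q)
    go (no np)         (inj₁ (e , _))   _        = ⊥-elim (np (here e))
    go (no np)         (inj₂ _)         (yes q)  = ⊥-elim (np (there q))
    go (no _)          (inj₂ (_ , δ0))  (no _)   = sym (cong (ℤ._+ 0ℤ) δ0)

  listSum-as-sumℤ : ∀ xs (h : ℕ → ℤ) M → Unique xs → (∀ x → x ∈ xs → x < M) →
                    listSum xs h ≡ sumℤ M (λ n → member xs n ℤ.* h n)
  listSum-as-sumℤ []       h M _         _  = sym (sumℤ-0 M)
  listSum-as-sumℤ (x ∷ xs) h M (x∉ ∷ u) bd = begin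
      h x ℤ.+ listSum xs h
        ≡⟨ cong₂ ℤ._+_ (sym (sumℤ-δ M x h (bd x (here refl)))) (listSum-as-sumℤ xs h M u (λ y y∈ → bd y (there y∈))) ⟩
      sumℤ M (λ n → δ x n ℤ.* h n) ℤ.+ sumℤ M (λ n → member xs n ℤ.* h n)
        ≡⟨ sym (sumℤ-+ M _ _) ⟩
      sumℤ M (λ n → δ x n ℤ.* h n ℤ.+ member xs n ℤ.* h n)
        ≡⟨ sumℤ-ext M (λ n → trans (sym (ℤP.*-distribʳ-+ (h n) (δ x n) (member xs n)))
                                   (cong (ℤ._* h n) (sym (member-∷ x xs n (λ x∈ → All.lookup x∉ x∈ refl))))) ⟩
      sumℤ M (λ n → member (x ∷ xs) n ℤ.* h n) ∎
    where open ≡-Reasoning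

  module Apéry (g : ℕ → ℕ) (k : ℕ) (pos : ∀ i → i ≤ k → 0 < g i) (sm : Smooth k g) (NR : List ℕ) (isNR : IsNR k g NR) where
    open SmoothSequence g k pos sm
    open Representations g k pos sm

    g₀ = g 0

    digitSum-as-sumℤ : ∀ M (f : ℕ → ℤ) → maxDigitValue (c g) g k < M →
                       digitSum (c g) g k f ≡ sumℤ M (λ m → representations k m ℤ.* f m)
    digitSum-as-sumℤ M f bd =
      trans (digitSum-cong (c g) g k (λ w w≤ → sym (trans (sumℤ-ext M (λ m → cong (ℤ._* f m) (δ-sym m w)))
                                                            (sumℤ-δ M w f (≤-<-trans w≤ bd)))))
        (trans (digitSum-sumℤ (c g) g k M (λ m w → δ m w ℤ.* f m))
          (sumℤ-ext M (λ m → trans (digitSum-ext (c g) g k (λ w → ℤP.*-comm (δ m w) (f m)))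
                                   (trans (digitSum-* (c g) g k (f m) (δ m)) (ℤP.*-comm (f m) (representations k m))))))

    inS : ℕ → Set
    inS n = InSG g (suc k) n

    NR⇒∉⟨G⟩ : ∀ {n} → n ∈ NR → ¬ inS n
    NR⇒∉⟨G⟩ {n} = proj₁ (proj₂ isNR n)

    ∉NR⇒¬¬∈⟨G⟩ : ∀ {n} → ¬ (n ∈ NR) → ¬ ¬ inS n
    ∉NR⇒¬¬∈⟨G⟩ {n} n∉ ¬s = n∉ (proj₂ (proj₂ isNR n) ¬s)

    shift : ∀ w j g₀ → w + suc j * g₀ ≡ (w + j * g₀) + g₀
    shift = ℕSolver.solve-∀

    represented⇒∈⟨G⟩ : ∀ {m} a → digitValue k a ≡ m → inS m
    represented⇒∈⟨G⟩ a e = subst inS (trans (+-identityʳ (digitValue k a)) e) (normalForm∈⟨G⟩ a 0)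

    ∈⟨G⟩-shift-up : ∀ {m} → g₀ ≤ m → inS (m ∸ g₀) → inS m
    ∈⟨G⟩-shift-up {m} g₀≤m (b , eqb) with normalForm k ≤-refl b
    ... | a , j , _ , e = subst inS (trans (shift (digitValue k a) j g₀) (trans (cong (_+ g₀) (trans (sym e) eqb)) (m∸n+n≡m g₀≤m)))
                                (normalForm∈⟨G⟩ a (suc j))

    unrepresented⇒shift : ∀ {m} → inS m → (∀ a → Digits k a → digitValue k a ≢ m) → g₀ ≤ m × inS (m ∸ g₀)
    unrepresented⇒shift {m} (b , eqb) none with normalForm k ≤-refl b
    ... | a , zero , va , e  = ⊥-elim (none a va (trans (sym (+-identityʳ (digitValue k a))) (trans (sym e) eqb)))
    ... | a , suc j , _ , e  =
      subst (g₀ ≤_) m≡ (m≤n+m g₀ _) ,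
      subst inS (trans (sym (m+n∸n≡m (digitValue k a + j * g₀) g₀)) (cong (_∸ g₀) m≡)) (normalForm∈⟨G⟩ a j)
      where
      m≡ : digitValue k a + j * g₀ + g₀ ≡ m
      m≡ = trans (sym (shift (digitValue k a) j g₀)) (trans (sym e) eqb)

    -- A digit value is not g₀ plus an element of ⟨G⟩ (uniqueness of normal forms).
    represented⇒shift-∉⟨G⟩ : ∀ {m} a → Digits k a → digitValue k a ≡ m → g₀ ≤ m → ¬ inS (m ∸ g₀)
    represented⇒shift-∉⟨G⟩ {m} a va ea g₀≤m (b , eqb) with normalForm k ≤-refl b
    ... | b' , j , vb' , e = 0≢1+n (normalForm-unique k ≤-refl a b' 0 (suc j) va vb'
        (trans (+-identityʳ (digitValue k a)) (trans ea (sym (trans (shift (digitValue k b') j g₀)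
          (trans (cong (_+ g₀) (trans (sym e) eqb)) (m∸n+n≡m g₀≤m)))))))

    shiftedMember : ∀ {m} → Dec (m < g₀) → ℤ
    shiftedMember     (yes _) = 0ℤ
    shiftedMember {m} (no _)  = member NR (m ∸ g₀)

    below : ℕ → ℤ
    below m = indicator (m ℕ.<? g₀)

    apéry-identity : ∀ m → shiftedMember (m ℕ.<? g₀) ℤ.- member NR m ≡ representations k m ℤ.- below m
    apéry-identity m with m ℕ.<? g₀ | m ∈? NR | representations-0-or-1 k ≤-refl m
    ... | yes _   | yes _  | inj₁ (r0 , _)          = cong (ℤ._- 1ℤ) (sym r0)
    ... | yes _   | yes m∈ | inj₂ (_ , a , _ , e)   = ⊥-elim (NR⇒∉⟨G⟩ m∈ (represented⇒∈⟨G⟩ a e))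
    ... | yes _   | no _   | inj₂ (r1 , _)          = cong (ℤ._- 1ℤ) (sym r1)
    ... | yes m<g | no m∉  | inj₁ (_ , none)        =
      ⊥-elim (∉NR⇒¬¬∈⟨G⟩ m∉ (λ s → <⇒≱ m<g (proj₁ (unrepresented⇒shift s none))))
    ... | no m≮g  | dm     | rep                    = above (≮⇒≥ m≮g) dm ((m ∸ g₀) ∈? NR) rep
      where
      above : g₀ ≤ m → (dm : Dec (m ∈ NR)) → (dm' : Dec ((m ∸ g₀) ∈ NR)) → NoRepresentation k m ⊎ OneRepresentation k m →
              indicator dm' ℤ.- indicator dm ≡ representations k m ℤ.- 0ℤ
      above _   (yes _)  (yes _)   (inj₁ (r0 , _))         = cong (ℤ._- 0ℤ) (sym r0)
      above _   (yes m∈) _         (inj₂ (_ , a , _ , e))  = ⊥-elim (NR⇒∉⟨G⟩ m∈ (represented⇒∈⟨G⟩ a e))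
      above _   (no _)   (yes _)   (inj₂ (r1 , _))         = cong (ℤ._- 0ℤ) (sym r1)
      above _   (no m∉)  (yes m'∈) (inj₁ (_ , none))       =
        ⊥-elim (∉NR⇒¬¬∈⟨G⟩ m∉ (λ s → NR⇒∉⟨G⟩ m'∈ (proj₂ (unrepresented⇒shift s none))))
      above g≤m (yes m∈) (no m'∉) _                        =
        ⊥-elim (∉NR⇒¬¬∈⟨G⟩ m'∉ (λ s → NR⇒∉⟨G⟩ m∈ (∈⟨G⟩-shift-up g≤m s)))
      above _   (no _)   (no _)    (inj₁ (r0 , _))         = cong (ℤ._- 0ℤ) (sym r0)
      above g≤m (no _)   (no m'∉)  (inj₂ (_ , a , va , e)) =
        ⊥-elim (∉NR⇒¬¬∈⟨G⟩ m'∉ (represented⇒shift-∉⟨G⟩ a va e g≤m))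

    shiftedMember-below : ∀ m → m < g₀ → shiftedMember (m ℕ.<? g₀) ≡ 0ℤ
    shiftedMember-below m m<g with m ℕ.<? g₀
    ... | yes _  = refl
    ... | no m≮g = ⊥-elim (m≮g m<g)

    shiftedMember-above : ∀ i → shiftedMember ((g₀ + i) ℕ.<? g₀) ≡ member NR i
    shiftedMember-above i with (g₀ + i) ℕ.<? g₀
    ... | yes lt = ⊥-elim (<-irrefl refl (<-≤-trans lt (m≤m+n g₀ i)))
    ... | no _   = cong (member NR) (m+n∸m≡n g₀ i)

    below-lt : ∀ m → m < g₀ → below m ≡ 1ℤ
    below-lt m m<g with m ℕ.<? g₀
    ... | yes _  = refl
    ... | no m≮g = ⊥-elim (m≮g m<g)

    below-ge : ∀ i → below (g₀ + i) ≡ 0ℤ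
    below-ge i with (g₀ + i) ℕ.<? g₀
    ... | yes lt = ⊥-elim (<-irrefl refl (<-≤-trans lt (m≤m+n g₀ i)))
    ... | no _   = refl

    N : ℕ
    N = suc (max 0 NR + maxDigitValue (c g) g k)

    NR<N : ∀ x → x ∈ NR → x < N
    NR<N x x∈ = s≤s (≤-trans (All.lookup (xs≤max 0 NR) x∈) (m≤m+n (max 0 NR) _))

    maxDigitValue<N : maxDigitValue (c g) g k < N
    maxDigitValue<N = s≤s (m≤n+m _ (max 0 NR))

    telescoping : ∀ (f : ℕ → ℤ) → listSum NR (λ n → f (n + g₀) ℤ.- f n) ≡ digitSum (c g) g k f ℤ.- sumℤ g₀ f
    telescoping f = begin
        listSum NR (λ n → f (n + g₀) ℤ.- f n)
          ≡⟨ listSum-as-sumℤ NR _ N (proj₁ isNR) NR<N ⟩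
        sumℤ N (λ n → member NR n ℤ.* (f (n + g₀) ℤ.- f n))
          ≡⟨ sumℤ-ext N (λ n → trans (distribˡ (member NR n) (f (n + g₀)) (f n))
                                     (cong (λ z → member NR n ℤ.* f z ℤ.- member NR n ℤ.* f n) (+-comm n g₀))) ⟩
        sumℤ N (λ n → member NR n ℤ.* f (g₀ + n) ℤ.- member NR n ℤ.* f n)
          ≡⟨ sumℤ-- N (λ n → member NR n ℤ.* f (g₀ + n)) (λ n → member NR n ℤ.* f n) ⟩
        sumℤ N (λ n → member NR n ℤ.* f (g₀ + n)) ℤ.- sumℤ N (λ n → member NR n ℤ.* f n)
          ≡⟨ cong₂ ℤ._-_ shifted-range extended-range ⟩
        sumℤ M (λ m → shiftedMember (m ℕ.<? g₀) ℤ.* f m) ℤ.- sumℤ M (λ m → member NR m ℤ.* f m)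
          ≡⟨ sym (sumℤ-- M (λ m → shiftedMember (m ℕ.<? g₀) ℤ.* f m) (λ m → member NR m ℤ.* f m)) ⟩
        sumℤ M (λ m → shiftedMember (m ℕ.<? g₀) ℤ.* f m ℤ.- member NR m ℤ.* f m)
          ≡⟨ sumℤ-ext M (λ m → trans (sym (distribʳ (f m) (shiftedMember (m ℕ.<? g₀)) (member NR m)))
                                     (trans (cong (ℤ._* f m) (apéry-identity m)) (distribʳ (f m) (representations k m) (below m)))) ⟩
        sumℤ M (λ m → representations k m ℤ.* f m ℤ.- below m ℤ.* f m)
          ≡⟨ sumℤ-- M (λ m → representations k m ℤ.* f m) (λ m → below m ℤ.* f m) ⟩
        sumℤ M (λ m → representations k m ℤ.* f m) ℤ.- sumℤ M (λ m → below m ℤ.* f m)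
          ≡⟨ cong₂ ℤ._-_ (sym (digitSum-as-sumℤ M f (<-≤-trans maxDigitValue<N (m≤n+m N g₀)))) initial-segment ⟩
        digitSum (c g) g k f ℤ.- sumℤ g₀ f ∎
      where
      open ≡-Reasoning
      M = g₀ + N
      distribˡ : ∀ a b c → a ℤ.* (b ℤ.- c) ≡ a ℤ.* b ℤ.- a ℤ.* c
      distribˡ = solve-∀
      distribʳ : ∀ x a b → (a ℤ.- b) ℤ.* x ≡ a ℤ.* x ℤ.- b ℤ.* x
      distribʳ = solve-∀
      -- Reindex n ↦ g₀ + n; the new first g₀ terms vanish.
      shifted-range : sumℤ N (λ n → member NR n ℤ.* f (g₀ + n)) ≡ sumℤ M (λ m → shiftedMember (m ℕ.<? g₀) ℤ.* f m)
      shifted-range = sym (trans (sumℤ-split g₀ N (λ m → shiftedMember (m ℕ.<? g₀) ℤ.* f m))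
        (trans (cong₂ ℤ._+_ (trans (sumℤ-cong g₀ (λ m m< → trans (cong (ℤ._* f m) (shiftedMember-below m m<)) (ℤP.*-zeroˡ (f m))))
                                   (sumℤ-0 g₀))
                            (sumℤ-ext N (λ i → cong (ℤ._* f (g₀ + i)) (shiftedMember-above i))))
               (ℤP.+-identityˡ _)))
      -- Extending the range past N adds only zeros, since NR ⊆ [0, N).
      extended-range : sumℤ N (λ n → member NR n ℤ.* f n) ≡ sumℤ M (λ m → member NR m ℤ.* f m)
      extended-range = sym (trans (cong (λ z → sumℤ z (λ m → member NR m ℤ.* f m)) (+-comm g₀ N))
        (trans (sumℤ-split N g₀ (λ m → member NR m ℤ.* f m))
          (trans (cong (ℤ._+_ (sumℤ N (λ m → member NR m ℤ.* f m)))
                       (trans (sumℤ-ext g₀ (λ i → trans (cong (ℤ._* f (N + i)) (member-outside NR (N + i)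
                                                                  (λ x∈ → <-irrefl refl (<-≤-trans (NR<N _ x∈) (m≤m+n N i)))))
                                                        (ℤP.*-zeroˡ (f (N + i)))))
                              (sumℤ-0 g₀)))
                 (ℤP.+-identityʳ _))))
      initial-segment : sumℤ M (λ m → below m ℤ.* f m) ≡ sumℤ g₀ f
      initial-segment = trans (sumℤ-split g₀ N (λ m → below m ℤ.* f m))
        (trans (cong₂ ℤ._+_ (sumℤ-cong g₀ (λ m m< → trans (cong (ℤ._* f m) (below-lt m m<)) (ℤP.*-identityˡ (f m))))
                            (trans (sumℤ-ext N (λ i → trans (cong (ℤ._* f (g₀ + i)) (below-ge i)) (ℤP.*-zeroˡ (f (g₀ + i)))))
                                   (sumℤ-0 N)))
               (ℤP.+-identityʳ _))

-- For a multiplicative weight σ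
-- (σ(x + y) = σ x σ y) the digit sum of σ(w) wʲ at level i+1 is a binomial
-- convolution of the level-i sums with the sums over the single position i+1.
-- We record the sums for j ≤ 3 through a "profile" (mass m, twice the mean u,
-- twelve times the variance v, third central moment 0); profiles add under
-- convolution, so they are computed position by position.
module DigitMoments where
  open FiniteSums
  open import Data.Nat as ℕ using (ℕ; zero; suc; _∸_)
  import Data.Nat.Properties as ℕP
  import Data.Nat.Combinatorics as Comb
  open import Data.Integer using (ℤ; +_; 0ℤ; 1ℤ; _+_; _*_)
  import Data.Integer.Properties as ℤP
  open import Data.Integer.Tactic.RingSolver using (solve-∀)
  open import Relation.Binary.PropositionalEquality

  power : ℕ → ℤ → ℤ
  power 0 x = 1ℤ
  power 1 x = x
  power 2 x = x * x
  power 3 x = x * x * x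
  power _ x = 0ℤ

  binom : ℕ → ℕ → ℤ
  binom j r = + (j Comb.C r)

  sumℤ-swap : ∀ n m (h : ℕ → ℕ → ℤ) → sumℤ n (λ i → sumℤ m (h i)) ≡ sumℤ m (λ j → sumℤ n (λ i → h i j))
  sumℤ-swap zero    m h = sym (sumℤ-0 m)
  sumℤ-swap (suc n) m h = trans (cong (_+_ (sumℤ m (h 0))) (sumℤ-swap n m (λ i → h (suc i))))
                                (sym (sumℤ-+ m (h 0) (λ j → sumℤ n (λ i → h (suc i) j))))

  separate : ∀ cc gg i C n (F : ℕ → ℕ → ℤ) (K : ℕ → ℤ) (U V : ℕ → ℕ → ℤ) →
             (∀ x a → F x a ≡ sumℤ n (λ r → K r * U r x * V r a)) →
             digitSum cc gg i (λ x → sumℤ C (F x)) ≡ sumℤ n (λ r → K r * sumℤ C (V r) * digitSum cc gg i (U r))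
  separate cc gg i C n F K U V sep = begin
      digitSum cc gg i (λ x → sumℤ C (F x))
        ≡⟨ digitSum-ext cc gg i (λ x → trans (sumℤ-ext C (sep x)) (sumℤ-swap C n _)) ⟩
      digitSum cc gg i (λ x → sumℤ n (λ r → sumℤ C (λ a → K r * U r x * V r a)))
        ≡⟨ digitSum-sumℤ cc gg i n _ ⟩
      sumℤ n (λ r → digitSum cc gg i (λ x → sumℤ C (λ a → K r * U r x * V r a)))
        ≡⟨ sumℤ-ext n (λ r → trans (digitSum-ext cc gg i (λ x → trans (sumℤ-* C (K r * U r x) (V r)) (rearrange (K r) (U r x) _)))
                                   (digitSum-* cc gg i (K r * sumℤ C (V r)) (U r))) ⟩
      sumℤ n (λ r → K r * sumℤ C (V r) * digitSum cc gg i (U r)) ∎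
    where
    open ≡-Reasoning
    rearrange : ∀ k u s → k * u * s ≡ k * s * u
    rearrange = solve-∀

  binomial : ∀ j → j ℕ.≤ 3 → ∀ s t X Y → (s * t) * power j (X + Y) ≡ sumℤ (suc j) (λ r → binom j r * (s * power (j ∸ r) X) * (t * power r Y))
  binomial 0 _ = expand0
    where
    expand0 : ∀ s t X Y → (s * t) * 1ℤ ≡ + 1 * (s * 1ℤ) * (t * 1ℤ) + 0ℤ
    expand0 = solve-∀
  binomial 1 _ = expand1
    where
    expand1 : ∀ s t X Y → (s * t) * (X + Y) ≡ + 1 * (s * X) * (t * 1ℤ) + (+ 1 * (s * 1ℤ) * (t * Y) + 0ℤ)
    expand1 = solve-∀
  binomial 2 _ = expand2
    where
    expand2 : ∀ s t X Y → (s * t) * ((X + Y) * (X + Y)) ≡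
              + 1 * (s * (X * X)) * (t * 1ℤ) + (+ 2 * (s * X) * (t * Y) + (+ 1 * (s * 1ℤ) * (t * (Y * Y)) + 0ℤ))
    expand2 = solve-∀
  binomial 3 _ = expand3
    where
    expand3 : ∀ s t X Y → (s * t) * ((X + Y) * (X + Y) * (X + Y)) ≡
              + 1 * (s * (X * X * X)) * (t * 1ℤ) + (+ 3 * (s * (X * X)) * (t * Y) +
              (+ 3 * (s * X) * (t * (Y * Y)) + (+ 1 * (s * 1ℤ) * (t * (Y * Y * Y)) + 0ℤ)))
    expand3 = solve-∀
  binomial (suc (suc (suc (suc _)))) (ℕ.s≤s (ℕ.s≤s (ℕ.s≤s ())))

  -- Profile of power sums M 0 … M 3: mass m, mean u/2, variance v/12, symmetric.
  record Profile (M : ℕ → ℤ) (m u v : ℤ) : Set where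
    constructor profile
    field
      moment₀ : M 0 ≡ m
      moment₁ : + 2 * M 1 ≡ m * u
      moment₂ : + 48 * M 2 ≡ m * (+ 12 * (u * u) + + 4 * v)
      moment₃ : + 8 * M 3 ≡ m * (u * u * u + u * v)

  convolve : ∀ (A B : ℕ → ℤ) m u v m' u' v' → Profile A m u v → Profile B m' u' v' →
             Profile (λ j → sumℤ (suc j) (λ r → binom j r * B r * A (j ∸ r))) (m * m') (u + u') (v + v')
  convolve A B m u v m' u' v' (profile refl a1 a2 a3) (profile refl b1 b2 b3) = profile mass mean second third
    where
    open ≡-Reasoning
    A0 = A 0
    B0 = B 0
    mass : + 1 * B0 * A0 + 0ℤ ≡ A0 * B0
    mass = commute B0 A0
      where
      commute : ∀ b a → + 1 * b * a + 0ℤ ≡ a * b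
      commute = solve-∀
    mean : + 2 * (+ 1 * B0 * A 1 + (+ 1 * B 1 * A0 + 0ℤ)) ≡ (A0 * B0) * (u + u')
    mean = begin
      + 2 * (+ 1 * B0 * A 1 + (+ 1 * B 1 * A0 + 0ℤ)) ≡⟨ expand B0 (B 1) A0 (A 1) ⟩
      B0 * (+ 2 * A 1) + (+ 2 * B 1) * A0            ≡⟨ cong₂ (λ x y → B0 * x + y * A0) a1 b1 ⟩
      B0 * (A0 * u) + (B0 * u') * A0                 ≡⟨ collect B0 A0 u u' ⟩
      (A0 * B0) * (u + u')                           ∎
      where
      expand : ∀ b0 b1 a0 a1 → + 2 * (+ 1 * b0 * a1 + (+ 1 * b1 * a0 + 0ℤ)) ≡ b0 * (+ 2 * a1) + (+ 2 * b1) * a0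
      expand = solve-∀
      collect : ∀ b0 a0 u u' → b0 * (a0 * u) + (b0 * u') * a0 ≡ (a0 * b0) * (u + u')
      collect = solve-∀
    second : + 48 * (+ 1 * B0 * A 2 + (+ 2 * B 1 * A 1 + (+ 1 * B 2 * A0 + 0ℤ))) ≡
             (A0 * B0) * (+ 12 * ((u + u') * (u + u')) + + 4 * (v + v'))
    second = begin
      + 48 * (+ 1 * B0 * A 2 + (+ 2 * B 1 * A 1 + (+ 1 * B 2 * A0 + 0ℤ)))
        ≡⟨ expand B0 (B 1) (B 2) A0 (A 1) (A 2) ⟩
      B0 * (+ 48 * A 2) + + 24 * (+ 2 * B 1) * (+ 2 * A 1) + (+ 48 * B 2) * A0
        ≡⟨ cong₂ (λ x y → B0 * x + + 24 * y * (+ 2 * A 1) + (+ 48 * B 2) * A0) a2 b1 ⟩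
      B0 * (A0 * (+ 12 * (u * u) + + 4 * v)) + + 24 * (B0 * u') * (+ 2 * A 1) + (+ 48 * B 2) * A0
        ≡⟨ cong₂ (λ x y → B0 * (A0 * (+ 12 * (u * u) + + 4 * v)) + + 24 * (B0 * u') * x + y * A0) a1 b2 ⟩
      B0 * (A0 * (+ 12 * (u * u) + + 4 * v)) + + 24 * (B0 * u') * (A0 * u) + (B0 * (+ 12 * (u' * u') + + 4 * v')) * A0
        ≡⟨ collect B0 A0 u v u' v' ⟩
      (A0 * B0) * (+ 12 * ((u + u') * (u + u')) + + 4 * (v + v')) ∎
      where
      expand : ∀ b0 b1 b2 a0 a1 a2 → + 48 * (+ 1 * b0 * a2 + (+ 2 * b1 * a1 + (+ 1 * b2 * a0 + 0ℤ))) ≡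
               b0 * (+ 48 * a2) + + 24 * (+ 2 * b1) * (+ 2 * a1) + (+ 48 * b2) * a0
      expand = solve-∀
      collect : ∀ b0 a0 u v u' v' → b0 * (a0 * (+ 12 * (u * u) + + 4 * v)) + + 24 * (b0 * u') * (a0 * u) + (b0 * (+ 12 * (u' * u') + + 4 * v')) * a0 ≡
                (a0 * b0) * (+ 12 * ((u + u') * (u + u')) + + 4 * (v + v'))
      collect = solve-∀
    third : + 8 * (+ 1 * B0 * A 3 + (+ 3 * B 1 * A 2 + (+ 3 * B 2 * A 1 + (+ 1 * B 3 * A0 + 0ℤ)))) ≡
            (A0 * B0) * ((u + u') * (u + u') * (u + u') + (u + u') * (v + v'))
    third = ℤP.*-cancelˡ-≡ (+ 4) _ _ (begin
      + 4 * (+ 8 * (+ 1 * B0 * A 3 + (+ 3 * B 1 * A 2 + (+ 3 * B 2 * A 1 + (+ 1 * B 3 * A0 + 0ℤ)))))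
        ≡⟨ expand B0 (B 1) (B 2) (B 3) A0 (A 1) (A 2) (A 3) ⟩
      + 4 * B0 * (+ 8 * A 3) + (+ 2 * B 1) * (+ 48 * A 2) + (+ 48 * B 2) * (+ 2 * A 1) + + 4 * (+ 8 * B 3) * A0
        ≡⟨ cong₂ (λ x y → + 4 * B0 * x + y * (+ 48 * A 2) + (+ 48 * B 2) * (+ 2 * A 1) + + 4 * (+ 8 * B 3) * A0) a3 b1 ⟩
      + 4 * B0 * (A0 * U3) + (B0 * u') * (+ 48 * A 2) + (+ 48 * B 2) * (+ 2 * A 1) + + 4 * (+ 8 * B 3) * A0
        ≡⟨ cong₂ (λ x y → + 4 * B0 * (A0 * U3) + (B0 * u') * x + y * (+ 2 * A 1) + + 4 * (+ 8 * B 3) * A0) a2 b2 ⟩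
      + 4 * B0 * (A0 * U3) + (B0 * u') * (A0 * U2) + (B0 * U2') * (+ 2 * A 1) + + 4 * (+ 8 * B 3) * A0
        ≡⟨ cong₂ (λ x y → + 4 * B0 * (A0 * U3) + (B0 * u') * (A0 * U2) + (B0 * U2') * x + + 4 * y * A0) a1 b3 ⟩
      + 4 * B0 * (A0 * U3) + (B0 * u') * (A0 * U2) + (B0 * U2') * (A0 * u) + + 4 * (B0 * U3') * A0
        ≡⟨ collect B0 A0 u v u' v' ⟩
      + 4 * ((A0 * B0) * ((u + u') * (u + u') * (u + u') + (u + u') * (v + v'))) ∎)
      where
      U2  = + 12 * (u * u) + + 4 * v
      U2' = + 12 * (u' * u') + + 4 * v'
      U3  = u * u * u + u * v
      U3' = u' * u' * u' + u' * v'
      expand : ∀ b0 b1 b2 b3 a0 a1 a2 a3 → + 4 * (+ 8 * (+ 1 * b0 * a3 + (+ 3 * b1 * a2 + (+ 3 * b2 * a1 + (+ 1 * b3 * a0 + 0ℤ))))) ≡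
               + 4 * b0 * (+ 8 * a3) + (+ 2 * b1) * (+ 48 * a2) + (+ 48 * b2) * (+ 2 * a1) + + 4 * (+ 8 * b3) * a0
      expand = solve-∀
      collect : ∀ b0 a0 u v u' v' →
                + 4 * b0 * (a0 * (u * u * u + u * v)) + (b0 * u') * (a0 * (+ 12 * (u * u) + + 4 * v))
                  + (b0 * (+ 12 * (u' * u') + + 4 * v')) * (a0 * u) + + 4 * (b0 * (u' * u' * u' + u' * v')) * a0 ≡
                + 4 * ((a0 * b0) * ((u + u') * (u + u') * (u + u') + (u + u') * (v + v')))
      collect = solve-∀

  Profile-cong : ∀ {M M' : ℕ → ℤ} {m u v} → (∀ j → j ℕ.≤ 3 → M j ≡ M' j) → Profile M m u v → Profile M' m u v
  Profile-cong {M} {M'} eq (profile p0 p1 p2 p3) = profile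
    (trans (sym (eq 0 ℕ.z≤n)) p0)
    (trans (cong (+ 2 *_) (sym (eq 1 (ℕ.s≤s ℕ.z≤n)))) p1)
    (trans (cong (+ 48 *_) (sym (eq 2 (ℕ.s≤s (ℕ.s≤s ℕ.z≤n))))) p2)
    (trans (cong (+ 8 *_) (sym (eq 3 (ℕ.s≤s (ℕ.s≤s (ℕ.s≤s ℕ.z≤n)))))) p3)

  module WeightedMoments (cc gg : ℕ → ℕ) (σ : ℕ → ℤ) (σ-+ : ∀ x y → σ (x ℕ.+ y) ≡ σ x * σ y) (σ-0 : σ 0 ≡ 1ℤ)
                         (fm fu fv : ℕ → ℤ) where

    moment : ℕ → ℕ → ℤ
    moment i j = digitSum cc gg i (λ w → σ w * power j (+ w))

    positionMoment : ℕ → ℕ → ℤ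
    positionMoment l r = sumℤ (cc l) (λ a → σ (a ℕ.* gg l) * power r (+ (a ℕ.* gg l)))

    mass twiceMean twelveVariance : ℕ → ℤ
    mass zero    = 1ℤ
    mass (suc i) = mass i * fm (suc i)
    twiceMean zero    = 0ℤ
    twiceMean (suc i) = twiceMean i + fu (suc i)
    twelveVariance zero    = 0ℤ
    twelveVariance (suc i) = twelveVariance i + fv (suc i)

    PositionProfile MomentProfile : ℕ → Set
    PositionProfile l = Profile (positionMoment l) (fm l) (fu l) (fv l)
    MomentProfile   i = Profile (moment i) (mass i) (twiceMean i) (twelveVariance i)

    moment-step : ∀ i j → j ℕ.≤ 3 →
                  moment (suc i) j ≡ sumℤ (suc j) (λ r → binom j r * positionMoment (suc i) r * moment i (j ∸ r))
    moment-step i j j≤3 = separate cc gg i (cc (suc i)) (suc j) _ (binom j)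
                            (λ r x → σ x * power (j ∸ r) (+ x)) (λ r a → σ (a ℕ.* G) * power r (+ (a ℕ.* G)))
                            (λ x a → trans (cong₂ (λ s y → s * power j y) (σ-+ x (a ℕ.* G)) (ℤP.pos-+ x (a ℕ.* G)))
                                           (binomial j j≤3 (σ x) (σ (a ℕ.* G)) (+ x) (+ (a ℕ.* G))))
      where G = gg (suc i)

    momentProfile-0 : MomentProfile 0
    momentProfile-0 = profile (trans (ℤP.*-identityʳ (σ 0)) σ-0)
                              (cong (+ 2 *_) (ℤP.*-zeroʳ (σ 0)))
                              (cong (+ 48 *_) (ℤP.*-zeroʳ (σ 0)))
                              (cong (+ 8 *_) (ℤP.*-zeroʳ (σ 0)))

    momentProfile-step : ∀ i → PositionProfile (suc i) → MomentProfile i → MomentProfile (suc i)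
    momentProfile-step i pos mom =
      Profile-cong (λ j j≤3 → sym (moment-step i j j≤3))
        (convolve (moment i) (positionMoment (suc i)) _ _ _ _ _ _ mom pos)

    momentProfile : ∀ I → (∀ i → suc i ℕ.≤ I → PositionProfile (suc i)) → ∀ i → i ℕ.≤ I → MomentProfile i
    momentProfile I pos zero    _    = momentProfile-0
    momentProfile I pos (suc i) si≤I = momentProfile-step i (pos i si≤I) (momentProfile I pos i (ℕP.≤-trans (ℕP.n≤1+n i) si≤I))

module ProgressionSums where
  open FiniteSums
  open DigitMoments
  open import Data.Nat as ℕ using (ℕ; zero; suc)
  import Data.Nat.Properties as ℕP
  open import Data.Nat.Divisibility using (_∣_; divides)
  open import Data.Nat.DivMod using (m≡m%n+[m/n]*n; m%n<n)
  import Data.Nat.Tactic.RingSolver as ℕSolver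
  open import Data.Integer using (ℤ; +_; 1ℤ; -1ℤ; _+_; _*_; _-_; _^_)
  import Data.Integer.Properties as ℤP
  open import Data.Integer.Tactic.RingSolver using (solve-∀)
  open import Relation.Nullary using (¬_)
  open import Data.Empty using (⊥-elim)
  open import Relation.Binary.PropositionalEquality
  open import Data.Product using (Σ; _,_)

  even⇒double : ∀ n → 2 ∣ n → Σ ℕ λ t → n ≡ t ℕ.+ t
  even⇒double n (divides q eq) = q , trans eq (double q)
    where
    double : ∀ t → t ℕ.* 2 ≡ t ℕ.+ t
    double = ℕSolver.solve-∀

  odd⇒double+1 : ∀ n → ¬ (2 ∣ n) → Σ ℕ λ t → n ≡ suc (t ℕ.+ t)
  odd⇒double+1 n n-odd with n ℕ.% 2 | m≡m%n+[m/n]*n n 2 | m%n<n n 2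
  ... | 0           | eq | _                 = ⊥-elim (n-odd (divides (n ℕ./ 2) eq))
  ... | 1           | eq | _                 = n ℕ./ 2 , trans eq (cong suc (double (n ℕ./ 2)))
    where
    double : ∀ t → t ℕ.* 2 ≡ t ℕ.+ t
    double = ℕSolver.solve-∀
  ... | suc (suc _) | _  | ℕ.s≤s (ℕ.s≤s ())

  sign : ℕ → ℤ
  sign n = -1ℤ ^ n

  sign-+ : ∀ x y → sign (x ℕ.+ y) ≡ sign x * sign y
  sign-+ x y = ℤP.^-distribˡ-+-* -1ℤ x y

  sign-even : ∀ t → sign (t ℕ.+ t) ≡ 1ℤ
  sign-even zero    = refl
  sign-even (suc t) = trans (cong (λ z → -1ℤ * sign z) (ℕP.+-suc t t)) (cong (λ z → -1ℤ * (-1ℤ * z)) (sign-even t))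

  sign-*-even : ∀ a t → sign (a ℕ.* (t ℕ.+ t)) ≡ 1ℤ
  sign-*-even a t = trans (cong sign (ℕP.*-distribˡ-+ a t t)) (sign-even (a ℕ.* t))

  sign-*-odd : ∀ a t → sign (a ℕ.* suc (t ℕ.+ t)) ≡ sign a
  sign-*-odd a t = trans (cong sign (ℕP.*-suc a (t ℕ.+ t)))
                     (trans (sign-+ a _) (trans (cong (sign a *_) (sign-*-even a t)) (ℤP.*-identityʳ (sign a))))

  scaled-step : ∀ (k F x A : ℤ) → k * F ≡ A → k * (F + x) ≡ A + k * x
  scaled-step k F x A h = trans (ℤP.*-distribˡ-+ k F x) (cong (_+ k * x) h)

  module _ (G : ℕ) where
    progressionSum : ℕ → ℕ → ℤ
    progressionSum r C = sumℤ C (λ a → 1ℤ * power r (+ (a ℕ.* G)))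

    progressionSum-last : ∀ r C → progressionSum r (suc C) ≡ progressionSum r C + 1ℤ * power r (+ C * + G)
    progressionSum-last r C = trans (sumℤ-last C _) (cong (λ z → progressionSum r C + 1ℤ * power r z) (ℤP.pos-* C G))

    progression-profile : ∀ C → Profile (λ r → progressionSum r C) (+ C) ((+ C - 1ℤ) * + G) ((+ C * + C - 1ℤ) * (+ G * + G))
    progression-profile zero    = profile refl refl refl refl
    progression-profile (suc C) with progression-profile C
    ... | profile p0 p1 p2 p3 = profile
      (trans (progressionSum-last 0 C) (trans (cong (_+ 1ℤ) p0) (sym (trans (ℤP.pos-+ 1 C) (ℤP.+-comm 1ℤ (+ C))))))
      (step (+ 2) 1 (λ X → X * ((X - 1ℤ) * + G)) p1 (grow1 (+ C) (+ G)))
      (step (+ 48) 2 (λ X → X * (+ 12 * (((X - 1ℤ) * + G) * ((X - 1ℤ) * + G)) + + 4 * ((X * X - 1ℤ) * (+ G * + G)))) p2 (grow2 (+ C) (+ G)))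
      (step (+ 8) 3 (λ X → X * (((X - 1ℤ) * + G) * ((X - 1ℤ) * + G) * ((X - 1ℤ) * + G) + ((X - 1ℤ) * + G) * ((X * X - 1ℤ) * (+ G * + G)))) p3 (grow3 (+ C) (+ G)))
      where
      step : ∀ κ r {A} (R : ℤ → ℤ) → κ * progressionSum r C ≡ A → A + κ * (1ℤ * power r (+ C * + G)) ≡ R (1ℤ + + C) →
             κ * progressionSum r (suc C) ≡ R (+ suc C)
      step κ r R h e = trans (cong (κ *_) (progressionSum-last r C))
                         (trans (scaled-step κ _ _ _ h) (trans e (cong R (sym (ℤP.pos-+ 1 C)))))
      grow1 : ∀ X Y → X * ((X - 1ℤ) * Y) + + 2 * (1ℤ * (X * Y)) ≡ (1ℤ + X) * (((1ℤ + X) - 1ℤ) * Y)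
      grow1 = solve-∀
      grow2 : ∀ X Y → X * (+ 12 * (((X - 1ℤ) * Y) * ((X - 1ℤ) * Y)) + + 4 * ((X * X - 1ℤ) * (Y * Y))) + + 48 * (1ℤ * (X * Y * (X * Y)))
                      ≡ (1ℤ + X) * (+ 12 * ((((1ℤ + X) - 1ℤ) * Y) * (((1ℤ + X) - 1ℤ) * Y)) + + 4 * (((1ℤ + X) * (1ℤ + X) - 1ℤ) * (Y * Y)))
      grow2 = solve-∀
      grow3 : ∀ X Y → X * (((X - 1ℤ) * Y) * ((X - 1ℤ) * Y) * ((X - 1ℤ) * Y) + ((X - 1ℤ) * Y) * ((X * X - 1ℤ) * (Y * Y))) + + 8 * (1ℤ * (X * Y * (X * Y) * (X * Y)))
                      ≡ (1ℤ + X) * ((((1ℤ + X) - 1ℤ) * Y) * (((1ℤ + X) - 1ℤ) * Y) * (((1ℤ + X) - 1ℤ) * Y) + (((1ℤ + X) - 1ℤ) * Y) * (((1ℤ + X) * (1ℤ + X) - 1ℤ) * (Y * Y)))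
      grow3 = solve-∀

    altProgressionSum : ℕ → ℕ → ℤ
    altProgressionSum r t = sumℤ (suc (t ℕ.+ t)) (λ a → sign a * power r (+ a * + G))

    oddLength : ℕ → ℤ
    oddLength t = 1ℤ + (+ t + + t)

    oddLength≡ : ∀ t → + suc (t ℕ.+ t) ≡ oddLength t
    oddLength≡ t = trans (ℤP.pos-+ 1 (t ℕ.+ t)) (cong (_+_ 1ℤ) (ℤP.pos-+ t t))

    altProgressionSum-last2 : ∀ r t → altProgressionSum r (suc t) ≡
      altProgressionSum r t + -1ℤ * power r ((1ℤ + (+ t + + t)) * + G) + 1ℤ * power r ((+ 2 + (+ t + + t)) * + G)
    altProgressionSum-last2 r t = begin
        altProgressionSum r (suc t)
          ≡⟨ cong (λ n → sumℤ (suc (suc n)) f) (ℕP.+-suc t t) ⟩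
        sumℤ (suc (suc (suc (t ℕ.+ t)))) f
          ≡⟨ sumℤ-last (suc (suc (t ℕ.+ t))) f ⟩
        sumℤ (suc (suc (t ℕ.+ t))) f + f (suc (suc (t ℕ.+ t)))
          ≡⟨ cong (_+ f (suc (suc (t ℕ.+ t)))) (sumℤ-last (suc (t ℕ.+ t)) f) ⟩
        altProgressionSum r t + f (suc (t ℕ.+ t)) + f (suc (suc (t ℕ.+ t)))
          ≡⟨ cong₂ (λ P Q → altProgressionSum r t + P + Q) odd-term even-term ⟩
        altProgressionSum r t + -1ℤ * power r ((1ℤ + (+ t + + t)) * + G) + 1ℤ * power r ((+ 2 + (+ t + + t)) * + G) ∎
      where
      open ≡-Reasoning
      f : ℕ → ℤ
      f a = sign a * power r (+ a * + G)
      odd-term : f (suc (t ℕ.+ t)) ≡ -1ℤ * power r ((1ℤ + (+ t + + t)) * + G)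
      odd-term = cong₂ (λ s z → s * power r (z * + G)) (cong (-1ℤ *_) (sign-even t)) (oddLength≡ t)
      even-term : f (suc (suc (t ℕ.+ t))) ≡ 1ℤ * power r ((+ 2 + (+ t + + t)) * + G)
      even-term = cong₂ (λ s z → s * power r (z * + G)) (cong (λ z → -1ℤ * (-1ℤ * z)) (sign-even t))
                        (trans (ℤP.pos-+ 2 (t ℕ.+ t)) (cong (_+_ (+ 2)) (ℤP.pos-+ t t)))

    altProgression-profile : ∀ t → Profile (λ r → altProgressionSum r t) 1ℤ
                               ((oddLength t - 1ℤ) * + G) (+ 3 * ((oddLength t * oddLength t - 1ℤ) * (+ G * + G)))
    altProgression-profile zero    = profile refl refl refl refl
    altProgression-profile (suc t) with altProgression-profile t
    ... | profile p0 p1 p2 p3 = profile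
      (trans (altProgressionSum-last2 0 t) (cong (λ z → z + -1ℤ * 1ℤ + 1ℤ * 1ℤ) p0))
      (step (+ 2) 1 (λ X → 1ℤ * ((X - 1ℤ) * + G)) p1 (grow1 (+ t) (+ G)))
      (step (+ 48) 2 (λ X → 1ℤ * (+ 12 * (((X - 1ℤ) * + G) * ((X - 1ℤ) * + G)) + + 4 * (+ 3 * ((X * X - 1ℤ) * (+ G * + G))))) p2 (grow2 (+ t) (+ G)))
      (step (+ 8) 3 (λ X → 1ℤ * (((X - 1ℤ) * + G) * ((X - 1ℤ) * + G) * ((X - 1ℤ) * + G) + ((X - 1ℤ) * + G) * (+ 3 * ((X * X - 1ℤ) * (+ G * + G))))) p3 (grow3 (+ t) (+ G)))
      where
      step : ∀ κ r {A} (R : ℤ → ℤ) → κ * altProgressionSum r t ≡ A →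
             A + κ * (-1ℤ * power r ((1ℤ + (+ t + + t)) * + G)) + κ * (1ℤ * power r ((+ 2 + (+ t + + t)) * + G))
               ≡ R (1ℤ + (+ 1 + + t + (+ 1 + + t))) →
             κ * altProgressionSum r (suc t) ≡ R (oddLength (suc t))
      step κ r R h e = trans (cong (κ *_) (altProgressionSum-last2 r t))
                         (trans (scaled-step κ _ _ _ (scaled-step κ _ _ _ h))
                           (trans e (cong (λ z → R (1ℤ + (z + z))) (sym (ℤP.pos-+ 1 t)))))
      grow1 : ∀ T Y → 1ℤ * ((1ℤ + (T + T) - 1ℤ) * Y) + + 2 * (-1ℤ * ((1ℤ + (T + T)) * Y)) + + 2 * (1ℤ * ((+ 2 + (T + T)) * Y))
                      ≡ 1ℤ * ((1ℤ + (+ 1 + T + (+ 1 + T)) - 1ℤ) * Y)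
      grow1 = solve-∀
      grow2 : ∀ T Y → 1ℤ * (+ 12 * (((1ℤ + (T + T) - 1ℤ) * Y) * ((1ℤ + (T + T) - 1ℤ) * Y)) + + 4 * (+ 3 * (((1ℤ + (T + T)) * (1ℤ + (T + T)) - 1ℤ) * (Y * Y))))
                        + + 48 * (-1ℤ * ((1ℤ + (T + T)) * Y * ((1ℤ + (T + T)) * Y))) + + 48 * (1ℤ * ((+ 2 + (T + T)) * Y * ((+ 2 + (T + T)) * Y)))
                      ≡ 1ℤ * (+ 12 * (((1ℤ + (+ 1 + T + (+ 1 + T)) - 1ℤ) * Y) * ((1ℤ + (+ 1 + T + (+ 1 + T)) - 1ℤ) * Y)) + + 4 * (+ 3 * (((1ℤ + (+ 1 + T + (+ 1 + T))) * (1ℤ + (+ 1 + T + (+ 1 + T))) - 1ℤ) * (Y * Y))))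
      grow2 = solve-∀
      grow3 : ∀ T Y → 1ℤ * (((1ℤ + (T + T) - 1ℤ) * Y) * ((1ℤ + (T + T) - 1ℤ) * Y) * ((1ℤ + (T + T) - 1ℤ) * Y) + ((1ℤ + (T + T) - 1ℤ) * Y) * (+ 3 * (((1ℤ + (T + T)) * (1ℤ + (T + T)) - 1ℤ) * (Y * Y))))
                        + + 8 * (-1ℤ * ((1ℤ + (T + T)) * Y * ((1ℤ + (T + T)) * Y) * ((1ℤ + (T + T)) * Y))) + + 8 * (1ℤ * ((+ 2 + (T + T)) * Y * ((+ 2 + (T + T)) * Y) * ((+ 2 + (T + T)) * Y)))
                      ≡ 1ℤ * (((1ℤ + (+ 1 + T + (+ 1 + T)) - 1ℤ) * Y) * ((1ℤ + (+ 1 + T + (+ 1 + T)) - 1ℤ) * Y) * ((1ℤ + (+ 1 + T + (+ 1 + T)) - 1ℤ) * Y) + ((1ℤ + (+ 1 + T + (+ 1 + T)) - 1ℤ) * Y) * (+ 3 * (((1ℤ + (+ 1 + T + (+ 1 + T))) * (1ℤ + (+ 1 + T + (+ 1 + T))) - 1ℤ) * (Y * Y))))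
      grow3 = solve-∀

module Elimination where
  open FiniteSums
  open DigitMoments
  open Counting using (δ)
  open import Data.Nat as ℕ using (ℕ; suc; _∸_)
  open import Data.Integer using (ℤ; +_; 0ℤ; 1ℤ; -1ℤ; _+_; _*_; _-_; -_; NonZero)
  import Data.Integer.Properties as ℤP
  open import Data.Integer.Tactic.RingSolver using (solve-∀)
  open import Relation.Binary.PropositionalEquality

  -- Σ_{n∈NR} ((n+G)ʲ − nʲ) = Σ_{r<j} binom(j,r) G^{j−r} s_r.
  plainDifference : ℕ → ℤ → (ℕ → ℤ) → ℤ
  plainDifference j G s = sumℤ j (λ r → binom j r * power (j ∸ r) G * s r)

  -- For odd G:  Σ_{n∈NR} ((−1)^{n+G}(n+G)ʲ − (−1)ⁿnʲ) = −Σ_{r≤j} (binom(j,r) G^{j−r} + [r = j]) t_r.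
  altDifference : ℕ → ℤ → (ℕ → ℤ) → ℤ
  altDifference j G t = sumℤ (suc j) (λ r → - (binom j r * power (j ∸ r) G + δ j r) * t r)

  plainDifference-pointwise : ∀ j → 1 ℕ.≤ j → j ℕ.≤ 3 → ∀ N G →
    1ℤ * power j (N + G) - 1ℤ * power j N ≡ sumℤ j (λ r → binom j r * power (j ∸ r) G * power r N)
  plainDifference-pointwise 1 _ _ = expand1
    where
    expand1 : ∀ N G → 1ℤ * (N + G) - 1ℤ * N ≡ + 1 * G * 1ℤ + 0ℤ
    expand1 = solve-∀
  plainDifference-pointwise 2 _ _ = expand2
    where
    expand2 : ∀ N G → 1ℤ * ((N + G) * (N + G)) - 1ℤ * (N * N) ≡ + 1 * (G * G) * 1ℤ + (+ 2 * G * N + 0ℤ)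
    expand2 = solve-∀
  plainDifference-pointwise 3 _ _ = expand3
    where
    expand3 : ∀ N G → 1ℤ * ((N + G) * (N + G) * (N + G)) - 1ℤ * (N * N * N) ≡
              + 1 * (G * G * G) * 1ℤ + (+ 3 * (G * G) * N + (+ 3 * G * (N * N) + 0ℤ))
    expand3 = solve-∀
  plainDifference-pointwise (suc (suc (suc (suc _)))) _ (ℕ.s≤s (ℕ.s≤s (ℕ.s≤s ())))

  altDifference-pointwise : ∀ j → j ℕ.≤ 2 → ∀ σ N G →
    σ * -1ℤ * power j (N + G) - σ * power j N ≡ sumℤ (suc j) (λ r → - (binom j r * power (j ∸ r) G + δ j r) * (σ * power r N))
  altDifference-pointwise 0 _ = expand0
    where
    expand0 : ∀ σ N G → σ * -1ℤ * 1ℤ - σ * 1ℤ ≡ - (+ 1 * 1ℤ + 1ℤ) * (σ * 1ℤ) + 0ℤ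
    expand0 = solve-∀
  altDifference-pointwise 1 _ = expand1
    where
    expand1 : ∀ σ N G → σ * -1ℤ * (N + G) - σ * N ≡ - (+ 1 * G + 0ℤ) * (σ * 1ℤ) + (- (+ 1 * 1ℤ + 1ℤ) * (σ * N) + 0ℤ)
    expand1 = solve-∀
  altDifference-pointwise 2 _ = expand2
    where
    expand2 : ∀ σ N G → σ * -1ℤ * ((N + G) * (N + G)) - σ * (N * N) ≡
              - (+ 1 * (G * G) + 0ℤ) * (σ * 1ℤ) + (- (+ 2 * G + 0ℤ) * (σ * N) + (- (+ 1 * 1ℤ + 1ℤ) * (σ * (N * N)) + 0ℤ))
    expand2 = solve-∀
  altDifference-pointwise (suc (suc (suc _))) (ℕ.s≤s (ℕ.s≤s ()))

  cancel-via : ∀ κ L R X Y → .{{_ : NonZero κ}} → κ * L ≡ X → κ * R ≡ Y → X ≡ Y → L ≡ R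
  cancel-via κ L R X Y hL hR e = ℤP.*-cancelˡ-≡ κ L R (trans hL (trans e (sym hR)))

  *-distribˡ-− : ∀ κ a b → κ * (a - b) ≡ κ * a - κ * b
  *-distribˡ-− = solve-∀

  cong₃ : ∀ {A B C D : Set} (f : A → B → C → D) {a a' b b' c c'} → a ≡ a' → b ≡ b' → c ≡ c' → f a b c ≡ f a' b' c'
  cong₃ f refl refl refl = refl

  -- Plain sums: M is the digit moment (profile with mass G, parameters U, V) and
  -- F the sum over [0, G) (profile with mass G, parameters G − 1 and G² − 1).
  plain-degree-1 : ∀ G s M F U → .{{_ : NonZero G}} → plainDifference 1 G s ≡ M - F →
                   + 2 * M ≡ G * U → + 2 * F ≡ G * ((G - 1ℤ) * + 1) → + 2 * s 0 ≡ U - G + 1ℤ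
  plain-degree-1 G s M F U h hM hF = ℤP.*-cancelˡ-≡ G _ _ (begin
      G * (+ 2 * s 0)                  ≡⟨ scale G (s 0) ⟩
      + 2 * (+ 1 * G * s 0 + 0ℤ)       ≡⟨ cong (+ 2 *_) h ⟩
      + 2 * (M - F)                    ≡⟨ *-distribˡ-− (+ 2) M F ⟩
      + 2 * M - + 2 * F                ≡⟨ cong₂ _-_ hM hF ⟩
      G * U - G * ((G - 1ℤ) * + 1)     ≡⟨ collect G U ⟩
      G * (U - G + 1ℤ)                 ∎)
    where
    open ≡-Reasoning
    scale : ∀ G s0 → G * (+ 2 * s0) ≡ + 2 * (+ 1 * G * s0 + 0ℤ)
    scale = solve-∀
    collect : ∀ G U → G * U - G * ((G - 1ℤ) * + 1) ≡ G * (U - G + 1ℤ)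
    collect = solve-∀

  plain-degree-2 : ∀ G s M F U V → .{{_ : NonZero G}} → plainDifference 2 G s ≡ M - F →
                   + 48 * M ≡ G * (+ 12 * (U * U) + + 4 * V) →
                   + 48 * F ≡ G * (+ 12 * (((G - 1ℤ) * + 1) * ((G - 1ℤ) * + 1)) + + 4 * ((G * G - 1ℤ) * (+ 1 * + 1))) →
                   + 96 * s 1 + + 48 * G * s 0 ≡ + 12 * (U * U) + + 4 * V - (+ 12 * ((G - 1ℤ) * (G - 1ℤ)) + + 4 * (G * G - 1ℤ))
  plain-degree-2 G s M F U V h hM hF = ℤP.*-cancelˡ-≡ G _ _ (begin
      G * (+ 96 * s 1 + + 48 * G * s 0)                         ≡⟨ scale G (s 0) (s 1) ⟩
      + 48 * (+ 1 * (G * G) * s 0 + (+ 2 * G * s 1 + 0ℤ))      ≡⟨ cong (+ 48 *_) h ⟩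
      + 48 * (M - F)                                            ≡⟨ *-distribˡ-− (+ 48) M F ⟩
      + 48 * M - + 48 * F                                       ≡⟨ cong₂ _-_ hM hF ⟩
      G * (+ 12 * (U * U) + + 4 * V) - G * (+ 12 * (((G - 1ℤ) * + 1) * ((G - 1ℤ) * + 1)) + + 4 * ((G * G - 1ℤ) * (+ 1 * + 1)))
                                                                ≡⟨ collect G U V ⟩
      G * (+ 12 * (U * U) + + 4 * V - (+ 12 * ((G - 1ℤ) * (G - 1ℤ)) + + 4 * (G * G - 1ℤ))) ∎)
    where
    open ≡-Reasoning
    scale : ∀ G s0 s1 → G * (+ 96 * s1 + + 48 * G * s0) ≡ + 48 * (+ 1 * (G * G) * s0 + (+ 2 * G * s1 + 0ℤ))
    scale = solve-∀
    collect : ∀ G U V → G * (+ 12 * (U * U) + + 4 * V) - G * (+ 12 * (((G - 1ℤ) * + 1) * ((G - 1ℤ) * + 1)) + + 4 * ((G * G - 1ℤ) * (+ 1 * + 1)))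
                        ≡ G * (+ 12 * (U * U) + + 4 * V - (+ 12 * ((G - 1ℤ) * (G - 1ℤ)) + + 4 * (G * G - 1ℤ)))
    collect = solve-∀

  plain-degree-3 : ∀ G s M F U V → .{{_ : NonZero G}} → plainDifference 3 G s ≡ M - F →
                   + 8 * M ≡ G * (U * U * U + U * V) →
                   + 8 * F ≡ G * (((G - 1ℤ) * + 1) * ((G - 1ℤ) * + 1) * ((G - 1ℤ) * + 1) + ((G - 1ℤ) * + 1) * ((G * G - 1ℤ) * (+ 1 * + 1))) →
                   + 24 * s 2 + + 24 * G * s 1 + + 8 * G * G * s 0 ≡ U * U * U + U * V - ((G - 1ℤ) * (G - 1ℤ) * (G - 1ℤ) + (G - 1ℤ) * (G * G - 1ℤ))
  plain-degree-3 G s M F U V h hM hF = ℤP.*-cancelˡ-≡ G _ _ (begin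
      G * (+ 24 * s 2 + + 24 * G * s 1 + + 8 * G * G * s 0)                        ≡⟨ scale G (s 0) (s 1) (s 2) ⟩
      + 8 * (+ 1 * (G * G * G) * s 0 + (+ 3 * (G * G) * s 1 + (+ 3 * G * s 2 + 0ℤ))) ≡⟨ cong (+ 8 *_) h ⟩
      + 8 * (M - F)                                                                ≡⟨ *-distribˡ-− (+ 8) M F ⟩
      + 8 * M - + 8 * F                                                            ≡⟨ cong₂ _-_ hM hF ⟩
      G * (U * U * U + U * V) - G * (((G - 1ℤ) * + 1) * ((G - 1ℤ) * + 1) * ((G - 1ℤ) * + 1) + ((G - 1ℤ) * + 1) * ((G * G - 1ℤ) * (+ 1 * + 1)))
                                                                                   ≡⟨ collect G U V ⟩
      G * (U * U * U + U * V - ((G - 1ℤ) * (G - 1ℤ) * (G - 1ℤ) + (G - 1ℤ) * (G * G - 1ℤ))) ∎)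
    where
    open ≡-Reasoning
    scale : ∀ G s0 s1 s2 → G * (+ 24 * s2 + + 24 * G * s1 + + 8 * G * G * s0) ≡ + 8 * (+ 1 * (G * G * G) * s0 + (+ 3 * (G * G) * s1 + (+ 3 * G * s2 + 0ℤ)))
    scale = solve-∀
    collect : ∀ G U V → G * (U * U * U + U * V) - G * (((G - 1ℤ) * + 1) * ((G - 1ℤ) * + 1) * ((G - 1ℤ) * + 1) + ((G - 1ℤ) * + 1) * ((G * G - 1ℤ) * (+ 1 * + 1)))
                        ≡ G * (U * U * U + U * V - ((G - 1ℤ) * (G - 1ℤ) * (G - 1ℤ) + (G - 1ℤ) * (G * G - 1ℤ)))
    collect = solve-∀

  -- Alternating sums: M has mass P and parameters U, W; R is the alternating sum over [0, G).
  alt-degree-0 : ∀ G t M R P → altDifference 0 G t ≡ M - R → M ≡ P → R ≡ 1ℤ → + 2 * t 0 ≡ 1ℤ - P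
  alt-degree-0 G t M R P h refl refl = trans (negate (t 0)) (trans (cong -_ h) (flip M))
    where
    negate : ∀ t0 → + 2 * t0 ≡ - (- (+ 1 * 1ℤ + 1ℤ) * t0 + 0ℤ)
    negate = solve-∀
    flip : ∀ P → - (P - 1ℤ) ≡ 1ℤ - P
    flip = solve-∀

  alt-degree-1 : ∀ G t M R P U → altDifference 1 G t ≡ M - R → + 2 * M ≡ P * U → + 2 * R ≡ 1ℤ * ((G - 1ℤ) * + 1) →
                 + 4 * t 1 + + 2 * G * t 0 ≡ (G - 1ℤ) - P * U
  alt-degree-1 G t M R P U h hM hR = begin
      + 4 * t 1 + + 2 * G * t 0                 ≡⟨ negate G (t 0) (t 1) ⟩
      - (+ 2 * altDifference 1 G t)             ≡⟨ cong (λ z → - (+ 2 * z)) h ⟩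
      - (+ 2 * (M - R))                         ≡⟨ cong -_ (*-distribˡ-− (+ 2) M R) ⟩
      - (+ 2 * M - + 2 * R)                     ≡⟨ cong₂ (λ a b → - (a - b)) hM hR ⟩
      - (P * U - 1ℤ * ((G - 1ℤ) * + 1))         ≡⟨ collect G P U ⟩
      (G - 1ℤ) - P * U                          ∎
    where
    open ≡-Reasoning
    negate : ∀ G t0 t1 → + 4 * t1 + + 2 * G * t0 ≡ - (+ 2 * (- (+ 1 * G + 0ℤ) * t0 + (- (+ 1 * 1ℤ + 1ℤ) * t1 + 0ℤ)))
    negate = solve-∀
    collect : ∀ G P U → - (P * U - 1ℤ * ((G - 1ℤ) * + 1)) ≡ (G - 1ℤ) - P * U
    collect = solve-∀

  alt-degree-2 : ∀ G t M R P U W → altDifference 2 G t ≡ M - R →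
                 + 48 * M ≡ P * (+ 12 * (U * U) + + 4 * W) →
                 + 48 * R ≡ 1ℤ * (+ 12 * (((G - 1ℤ) * + 1) * ((G - 1ℤ) * + 1)) + + 4 * (+ 3 * ((G * G - 1ℤ) * (+ 1 * + 1)))) →
                 + 96 * t 2 + + 96 * G * t 1 + + 48 * G * G * t 0 ≡ + 12 * ((G - 1ℤ) * (G - 1ℤ)) + + 12 * (G * G - 1ℤ) - P * (+ 12 * (U * U) + + 4 * W)
  alt-degree-2 G t M R P U W h hM hR = begin
      + 96 * t 2 + + 96 * G * t 1 + + 48 * G * G * t 0   ≡⟨ negate G (t 0) (t 1) (t 2) ⟩
      - (+ 48 * altDifference 2 G t)                       ≡⟨ cong (λ z → - (+ 48 * z)) h ⟩
      - (+ 48 * (M - R))                                   ≡⟨ cong -_ (*-distribˡ-− (+ 48) M R) ⟩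
      - (+ 48 * M - + 48 * R)                              ≡⟨ cong₂ (λ a b → - (a - b)) hM hR ⟩
      - (P * (+ 12 * (U * U) + + 4 * W) - 1ℤ * (+ 12 * (((G - 1ℤ) * + 1) * ((G - 1ℤ) * + 1)) + + 4 * (+ 3 * ((G * G - 1ℤ) * (+ 1 * + 1)))))
                                                           ≡⟨ collect G P U W ⟩
      + 12 * ((G - 1ℤ) * (G - 1ℤ)) + + 12 * (G * G - 1ℤ) - P * (+ 12 * (U * U) + + 4 * W) ∎
    where
    open ≡-Reasoning
    negate : ∀ G t0 t1 t2 → + 96 * t2 + + 96 * G * t1 + + 48 * G * G * t0 ≡
             - (+ 48 * (- (+ 1 * (G * G) + 0ℤ) * t0 + (- (+ 2 * G + 0ℤ) * t1 + (- (+ 1 * 1ℤ + 1ℤ) * t2 + 0ℤ))))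
    negate = solve-∀
    collect : ∀ G P U W → - (P * (+ 12 * (U * U) + + 4 * W) - 1ℤ * (+ 12 * (((G - 1ℤ) * + 1) * ((G - 1ℤ) * + 1)) + + 4 * (+ 3 * ((G * G - 1ℤ) * (+ 1 * + 1)))))
                          ≡ + 12 * ((G - 1ℤ) * (G - 1ℤ)) + + 12 * (G * G - 1ℤ) - P * (+ 12 * (U * U) + + 4 * W)
    collect = solve-∀

  -- Solving the six normalised equations.  G = g₀, U and V are the plain profile
  -- parameters, P = Π_{i∈I_G} cᵢ and E = Σ_{i∈I_G} gᵢ²(cᵢ² − 1).
  module Solve (G U V E P s0 s1 s2 t0 t1 t2 : ℤ)
    (e-s0 : + 2 * s0 ≡ U - G + 1ℤ)
    (e-s1 : + 96 * s1 + + 48 * G * s0 ≡ + 12 * (U * U) + + 4 * V - (+ 12 * ((G - 1ℤ) * (G - 1ℤ)) + + 4 * (G * G - 1ℤ)))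
    (e-s2 : + 24 * s2 + + 24 * G * s1 + + 8 * G * G * s0 ≡ U * U * U + U * V - ((G - 1ℤ) * (G - 1ℤ) * (G - 1ℤ) + (G - 1ℤ) * (G * G - 1ℤ)))
    (e-t0 : + 2 * t0 ≡ 1ℤ - P)
    (e-t1 : + 4 * t1 + + 2 * G * t0 ≡ (G - 1ℤ) - P * U)
    (e-t2 : + 96 * t2 + + 96 * G * t1 + + 48 * G * G * t0 ≡ + 12 * ((G - 1ℤ) * (G - 1ℤ)) + + 12 * (G * G - 1ℤ) - P * (+ 12 * (U * U) + + 4 * (+ 3 * V - + 2 * E)))
    where
    open ≡-Reasoning

    T₁-formula : + 4 * t1 ≡ - (1ℤ + (+ 2 * s0 - 1ℤ) * P)
    T₁-formula = begin
        + 4 * t1                                   ≡⟨ isolate G t0 t1 ⟩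
        (+ 4 * t1 + + 2 * G * t0) - G * (+ 2 * t0) ≡⟨ cong₂ (λ a b → a - G * b) e-t1 e-t0 ⟩
        ((G - 1ℤ) - P * U) - G * (1ℤ - P)          ≡⟨ collect G P U ⟩
        - (1ℤ + ((U - G + 1ℤ) - 1ℤ) * P)           ≡⟨ cong (λ z → - (1ℤ + (z - 1ℤ) * P)) (sym e-s0) ⟩
        - (1ℤ + (+ 2 * s0 - 1ℤ) * P)               ∎
      where
      isolate : ∀ G t0 t1 → + 4 * t1 ≡ (+ 4 * t1 + + 2 * G * t0) - G * (+ 2 * t0)
      isolate = solve-∀
      collect : ∀ G P U → ((G - 1ℤ) - P * U) - G * (1ℤ - P) ≡ - (1ℤ + ((U - G + 1ℤ) - 1ℤ) * P)
      collect = solve-∀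

    -- Eliminating t₀, t₁ and U, V via the s-equations; both sides are compared after scaling by 96.
    T₂-formula : + 12 * (+ 2 * s0 - 1ℤ) * t2 ≡ - ((+ 36 * s2 - (+ 2 * s0 - 1ℤ) * E) * P)
    T₂-formula = cancel-via (+ 96) _ _ _ _ (lhs s0 t0 t1 t2 G) (rhs s0 s1 s2 G E P)
      (trans (cong₃ (λ a x y → + 12 * (a - 1ℤ) * (x - + 24 * G * y)) e-s0 e-t2 e-t1)
        (trans (eliminate G U V E P)
          (sym (cong₃ (λ a b1 b2 → - ((+ 144 * b2 - + 36 * G * b1 + + 288 * G * G * a - + 96 * (a - 1ℤ) * E) * P)) e-s0 e-s1 e-s2))))
      where
      lhs : ∀ s0 t0 t1 t2 G → + 96 * (+ 12 * (+ 2 * s0 - 1ℤ) * t2) ≡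
            + 12 * ((+ 2 * s0) - 1ℤ) * ((+ 96 * t2 + + 96 * G * t1 + + 48 * G * G * t0) - + 24 * G * (+ 4 * t1 + + 2 * G * t0))
      lhs = solve-∀
      rhs : ∀ s0 s1 s2 G E P → + 96 * (- ((+ 36 * s2 - (+ 2 * s0 - 1ℤ) * E) * P)) ≡
            - ((+ 144 * (+ 24 * s2 + + 24 * G * s1 + + 8 * G * G * s0) - + 36 * G * (+ 96 * s1 + + 48 * G * s0)
                + + 288 * G * G * (+ 2 * s0) - + 96 * ((+ 2 * s0) - 1ℤ) * E) * P)
      rhs = solve-∀
      eliminate : ∀ G U V E P →
        + 12 * ((U - G + 1ℤ) - 1ℤ) * ((+ 12 * ((G - 1ℤ) * (G - 1ℤ)) + + 12 * (G * G - 1ℤ) - P * (+ 12 * (U * U) + + 4 * (+ 3 * V - + 2 * E)))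
                                     - + 24 * G * ((G - 1ℤ) - P * U))
        ≡ - ((+ 144 * (U * U * U + U * V - ((G - 1ℤ) * (G - 1ℤ) * (G - 1ℤ) + (G - 1ℤ) * (G * G - 1ℤ)))
              - + 36 * G * (+ 12 * (U * U) + + 4 * V - (+ 12 * ((G - 1ℤ) * (G - 1ℤ)) + + 4 * (G * G - 1ℤ)))
              + + 288 * G * G * (U - G + 1ℤ) - + 96 * ((U - G + 1ℤ) - 1ℤ) * E) * P)
      eliminate = solve-∀

    module AllOdd (P≡1 : P ≡ 1ℤ) (E≡0 : E ≡ 0ℤ) where
      e-t0' : + 2 * t0 ≡ 1ℤ - 1ℤ
      e-t0' = subst (λ z → + 2 * t0 ≡ 1ℤ - z) P≡1 e-t0
      e-t1' : + 4 * t1 + + 2 * G * t0 ≡ (G - 1ℤ) - 1ℤ * U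
      e-t1' = subst (λ z → + 4 * t1 + + 2 * G * t0 ≡ (G - 1ℤ) - z * U) P≡1 e-t1
      e-t2' : + 96 * t2 + + 96 * G * t1 + + 48 * G * G * t0 ≡ + 12 * ((G - 1ℤ) * (G - 1ℤ)) + + 12 * (G * G - 1ℤ) - 1ℤ * (+ 12 * (U * U) + + 4 * (+ 3 * V - + 2 * 0ℤ))
      e-t2' = subst₂ (λ z w → + 96 * t2 + + 96 * G * t1 + + 48 * G * G * t0 ≡ + 12 * ((G - 1ℤ) * (G - 1ℤ)) + + 12 * (G * G - 1ℤ) - z * (+ 12 * (U * U) + + 4 * (+ 3 * V - + 2 * w))) P≡1 E≡0 e-t2

      T₀-zero : t0 ≡ 0ℤ
      T₀-zero = ℤP.*-cancelˡ-≡ (+ 2) t0 0ℤ e-t0'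

      T₁-half-S₀ : + 2 * t1 ≡ - s0
      T₁-half-S₀ = cancel-via (+ 2) _ _ _ _ (isolate G t0 t1) (negate s0)
                     (trans (cong₂ (λ x y → x - G * y) e-t1' e-t0') (trans (collect G U) (sym (cong -_ e-s0))))
        where
        isolate : ∀ G t0 t1 → + 2 * (+ 2 * t1) ≡ (+ 4 * t1 + + 2 * G * t0) - G * (+ 2 * t0)
        isolate = solve-∀
        negate : ∀ s0 → + 2 * (- s0) ≡ - (+ 2 * s0)
        negate = solve-∀
        collect : ∀ G U → ((G - 1ℤ) - 1ℤ * U) - G * (1ℤ - 1ℤ) ≡ - (U - G + 1ℤ)
        collect = solve-∀

      T₂-via-S₀ : + 8 * t2 ≡ - (+ 4 * (s0 * (s0 - 1ℤ))) - (1ℤ - G * G + V)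
      T₂-via-S₀ = cancel-via (+ 12) _ _ _ _ (isolate G t0 t1 t2) (expand s0 G V)
                    (trans (cong₂ (λ x y → x - + 24 * G * y) e-t2' e-t1')
                      (trans (collect G U V) (sym (cong (λ a → - (+ 12 * (a * (a - + 2))) - + 12 * (1ℤ - G * G + V)) e-s0))))
        where
        isolate : ∀ G t0 t1 t2 → + 12 * (+ 8 * t2) ≡ (+ 96 * t2 + + 96 * G * t1 + + 48 * G * G * t0) - + 24 * G * (+ 4 * t1 + + 2 * G * t0)
        isolate = solve-∀
        expand : ∀ s0 G V → + 12 * (- (+ 4 * (s0 * (s0 - 1ℤ))) - (1ℤ - G * G + V)) ≡
                 - (+ 12 * ((+ 2 * s0) * ((+ 2 * s0) - + 2))) - + 12 * (1ℤ - G * G + V)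
        expand = solve-∀
        collect : ∀ G U V → (+ 12 * ((G - 1ℤ) * (G - 1ℤ)) + + 12 * (G * G - 1ℤ) - 1ℤ * (+ 12 * (U * U) + + 4 * (+ 3 * V - + 2 * 0ℤ)))
                              - + 24 * G * ((G - 1ℤ) - 1ℤ * U)
                            ≡ - (+ 12 * ((U - G + 1ℤ) * ((U - G + 1ℤ) - + 2))) - + 12 * (1ℤ - G * G + V)
        collect = solve-∀

      T₂-via-S₂ : (+ 2 * s0 - 1ℤ) * t2 ≡ - (+ 3 * s2)
      T₂-via-S₂ = cancel-via (+ 96) _ _ _ _ (isolate s0 G t0 t1 t2) (expand s0 s1 s2 G)
                    (trans (cong₃ (λ a x y → (a - 1ℤ) * (x - + 24 * G * y)) e-s0 e-t2' e-t1')
                      (trans (eliminate G U V) (sym (cong₃ (λ a b1 b2 → - (+ 12 * b2 - + 3 * G * b1 + + 24 * G * G * a)) e-s0 e-s1 e-s2))))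
        where
        isolate : ∀ s0 G t0 t1 t2 → + 96 * ((+ 2 * s0 - 1ℤ) * t2) ≡
                  ((+ 2 * s0) - 1ℤ) * ((+ 96 * t2 + + 96 * G * t1 + + 48 * G * G * t0) - + 24 * G * (+ 4 * t1 + + 2 * G * t0))
        isolate = solve-∀
        expand : ∀ s0 s1 s2 G → + 96 * (- (+ 3 * s2)) ≡
                 - (+ 12 * (+ 24 * s2 + + 24 * G * s1 + + 8 * G * G * s0) - + 3 * G * (+ 96 * s1 + + 48 * G * s0) + + 24 * G * G * (+ 2 * s0))
        expand = solve-∀
        eliminate : ∀ G U V → ((U - G + 1ℤ) - 1ℤ) * ((+ 12 * ((G - 1ℤ) * (G - 1ℤ)) + + 12 * (G * G - 1ℤ) - 1ℤ * (+ 12 * (U * U) + + 4 * (+ 3 * V - + 2 * 0ℤ)))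
                                                      - + 24 * G * ((G - 1ℤ) - 1ℤ * U))
                    ≡ - (+ 12 * (U * U * U + U * V - ((G - 1ℤ) * (G - 1ℤ) * (G - 1ℤ) + (G - 1ℤ) * (G * G - 1ℤ)))
                         - + 3 * G * (+ 12 * (U * U) + + 4 * V - (+ 12 * ((G - 1ℤ) * (G - 1ℤ)) + + 4 * (G * G - 1ℤ))) + + 24 * G * G * (U - G + 1ℤ))
        eliminate = solve-∀

      T₂-via-T₁ : + 8 * t2 ≡ - (+ 16 * (t1 * t1)) - + 8 * t1 - (1ℤ - G * G + V)
      T₂-via-T₁ = cancel-via (+ 12) _ _ _ _ (isolate G t0 t1 t2) (expand G t0 t1 V)
                    (trans (cong₂ (λ x y → x - + 24 * G * y) e-t2' e-t1')
                      (trans (collect G U V) (sym (cong₂ (λ y z → - (+ 12 * ((y - G * z) * (y - G * z))) - + 24 * (y - G * z) - + 12 * (1ℤ - G * G + V)) e-t1' e-t0'))))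
        where
        isolate : ∀ G t0 t1 t2 → + 12 * (+ 8 * t2) ≡ (+ 96 * t2 + + 96 * G * t1 + + 48 * G * G * t0) - + 24 * G * (+ 4 * t1 + + 2 * G * t0)
        isolate = solve-∀
        expand : ∀ G t0 t1 V → + 12 * (- (+ 16 * (t1 * t1)) - + 8 * t1 - (1ℤ - G * G + V))
                 ≡ - (+ 12 * (((+ 4 * t1 + + 2 * G * t0) - G * (+ 2 * t0)) * ((+ 4 * t1 + + 2 * G * t0) - G * (+ 2 * t0))))
                   - + 24 * ((+ 4 * t1 + + 2 * G * t0) - G * (+ 2 * t0)) - + 12 * (1ℤ - G * G + V)
        expand = solve-∀
        collect : ∀ G U V → (+ 12 * ((G - 1ℤ) * (G - 1ℤ)) + + 12 * (G * G - 1ℤ) - 1ℤ * (+ 12 * (U * U) + + 4 * (+ 3 * V - + 2 * 0ℤ)))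
                              - + 24 * G * ((G - 1ℤ) - 1ℤ * U)
                            ≡ - (+ 12 * ((((G - 1ℤ) - 1ℤ * U) - G * (1ℤ - 1ℤ)) * (((G - 1ℤ) - 1ℤ * U) - G * (1ℤ - 1ℤ))))
                              - + 24 * (((G - 1ℤ) - 1ℤ * U) - G * (1ℤ - 1ℤ)) - + 12 * (1ℤ - G * G + V)
        collect = solve-∀

module Assembly where
  open import Defs
  open FiniteSums
  open NormalForm
  open Telescoping
  open DigitMoments
  open ProgressionSums
  open Elimination
  open Counting using (δ)
  open import Data.Nat as ℕ using (ℕ; zero; suc; _≤_; _<_; z≤n; s≤s)
  import Data.Nat.Properties as ℕP
  open import Data.Nat.Divisibility using (_∣_; _∣?_; ∣-trans; ∣-reflexive; m∣m*n)
  open import Data.Integer using (ℤ; +_; 0ℤ; 1ℤ; -1ℤ; _+_; _*_; _-_; -_)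
  import Data.Integer.Properties as ℤP
  open import Data.Integer.Tactic.RingSolver using (solve-∀)
  open import Data.List using (List; []; _∷_)
  open import Data.Bool using (if_then_else_)
  open import Relation.Nullary using (¬_; yes; no; does; Dec)
  open import Relation.Binary.PropositionalEquality
  open import Data.Product using (_×_; _,_; proj₁; proj₂)
  open import Data.Empty using (⊥-elim)

  listSum-ext : ∀ xs {f h : ℕ → ℤ} → (∀ n → f n ≡ h n) → listSum xs f ≡ listSum xs h
  listSum-ext []       eq = refl
  listSum-ext (x ∷ xs) eq = cong₂ _+_ (eq x) (listSum-ext xs eq)

  listSum-linear : ∀ xs m (K : ℕ → ℤ) (F : ℕ → ℕ → ℤ) →
                   listSum xs (λ n → sumℤ m (λ r → K r * F r n)) ≡ sumℤ m (λ r → K r * listSum xs (F r))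
  listSum-linear []       m K F = sym (trans (sumℤ-ext m (λ r → ℤP.*-zeroʳ (K r))) (sumℤ-0 m))
  listSum-linear (x ∷ xs) m K F = begin
      sumℤ m (λ r → K r * F r x) + listSum xs (λ n → sumℤ m (λ r → K r * F r n))
        ≡⟨ cong (_+_ (sumℤ m (λ r → K r * F r x))) (listSum-linear xs m K F) ⟩
      sumℤ m (λ r → K r * F r x) + sumℤ m (λ r → K r * listSum xs (F r))
        ≡⟨ sym (sumℤ-+ m (λ r → K r * F r x) (λ r → K r * listSum xs (F r))) ⟩
      sumℤ m (λ r → K r * F r x + K r * listSum xs (F r))
        ≡⟨ sumℤ-ext m (λ r → sym (ℤP.*-distribˡ-+ (K r) (F r x) (listSum xs (F r)))) ⟩
      sumℤ m (λ r → K r * (F r x + listSum xs (F r))) ∎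
    where open ≡-Reasoning

  module ForSequence (g : ℕ → ℕ) (k : ℕ) (pos : ∀ i → i ≤ k → 0 < g i) (sm : Smooth k g) (NR : List ℕ) (isNR : IsNR k g NR) where
    open SmoothSequence g k pos sm
    open Apéry g k pos sm NR isNR

    G : ℤ
    G = + g₀

    -- Position profiles: plain weight, and sign weight (which is trivial at even gₗ).
    plainMass plainU plainV altMass altV : ℕ → ℤ
    plainMass l = + c g l
    plainU    l = (+ c g l - 1ℤ) * + g l
    plainV    l = (+ c g l * + c g l - 1ℤ) * (+ g l * + g l)
    altMass   l = + (if does (2 ∣? g l) then c g l else 1)
    altV      l = (if does (2 ∣? g l) then 1ℤ else + 3) * plainV l

    module Plain = WeightedMoments (c g) g (λ _ → 1ℤ) (λ _ _ → refl) refl plainMass plainU plainV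
    module Alt   = WeightedMoments (c g) g sign sign-+ refl altMass plainU altV

    plainProfile : Plain.MomentProfile k
    plainProfile = Plain.momentProfile k (λ i _ → progression-profile (g (suc i)) (c g (suc i))) k ℕP.≤-refl

    c∣g₀ : ∀ i → suc i ≤ k → c g (suc i) ∣ g 0
    c∣g₀ i si≤k = ∣-trans (∣-trans (m∣m*n (d g (suc i))) (∣-reflexive (c*d i si≤k))) (d∣g₀ i)

    -- If g₀ is odd, so is every cᵢ; at an odd gᵢ the sign weight gives an alternating progression.
    alt-positions : ¬ (2 ∣ g 0) → ∀ i → suc i ≤ k → Alt.PositionProfile (suc i)
    alt-positions g₀-odd i si≤k = at-position (2 ∣? Gₗ)
      where
      Gₗ = g (suc i)
      C = c g (suc i)
      at-position : (dec : Dec (2 ∣ Gₗ)) → Profile (Alt.positionMoment (suc i)) (+ (if does dec then C else 1))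
                                                   (plainU (suc i)) ((if does dec then 1ℤ else + 3) * plainV (suc i))
      at-position (yes Geven) =
        subst (Profile (Alt.positionMoment (suc i)) (+ C) (plainU (suc i))) (sym (ℤP.*-identityˡ (plainV (suc i))))
          (Profile-cong (λ r _ → sumℤ-ext C (λ a → cong (_* power r (+ (a ℕ.* Gₗ))) (sym (sign-even-multiple a))))
            (progression-profile Gₗ C))
        where
        sign-even-multiple : ∀ a → sign (a ℕ.* Gₗ) ≡ 1ℤ
        sign-even-multiple a = trans (cong (λ z → sign (a ℕ.* z)) (proj₂ (even⇒double Gₗ Geven))) (sign-*-even a (proj₁ (even⇒double Gₗ Geven)))
      at-position (no Godd) =
        subst (λ X → Profile (Alt.positionMoment (suc i)) 1ℤ ((X - 1ℤ) * + Gₗ) (+ 3 * ((X * X - 1ℤ) * (+ Gₗ * + Gₗ)))) length≡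
          (Profile-cong (λ r _ → sym (alternating r)) (altProgression-profile Gₗ t))
        where
        C-odd : ¬ (2 ∣ C)
        C-odd 2∣C = g₀-odd (∣-trans 2∣C (c∣g₀ i si≤k))
        t = proj₁ (odd⇒double+1 C C-odd)
        C≡ = proj₂ (odd⇒double+1 C C-odd)
        length≡ : oddLength Gₗ t ≡ + C
        length≡ = trans (sym (oddLength≡ Gₗ t)) (cong +_ (sym C≡))
        alternating : ∀ r → Alt.positionMoment (suc i) r ≡ altProgressionSum Gₗ r t
        alternating r = trans (sumℤ-ext C (λ a → cong₂ (λ s z → s * power r z)
                                                 (trans (cong (λ z → sign (a ℕ.* z)) (proj₂ (odd⇒double+1 Gₗ Godd))) (sign-*-odd a (proj₁ (odd⇒double+1 Gₗ Godd))))
                                                 (ℤP.pos-* a Gₗ)))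
                              (cong (λ n → sumℤ n (λ a → sign a * power r (+ a * + Gₗ))) C≡)

    altProfile : ¬ (2 ∣ g 0) → Alt.MomentProfile k
    altProfile g₀-odd = Alt.momentProfile k (alt-positions g₀-odd) k ℕP.≤-refl

    plain-mass : ∀ i → i ≤ k → + d g i * Plain.mass i ≡ G
    plain-mass zero    _    = ℤP.*-identityʳ G
    plain-mass (suc i) si≤k = begin
        + d g (suc i) * (Plain.mass i * + c g (suc i))   ≡⟨ rearrange (+ d g (suc i)) (Plain.mass i) (+ c g (suc i)) ⟩
        (+ c g (suc i) * + d g (suc i)) * Plain.mass i   ≡⟨ cong (_* Plain.mass i) (trans (sym (ℤP.pos-* (c g (suc i)) (d g (suc i)))) (cong +_ (c*d i si≤k))) ⟩
        + d g i * Plain.mass i                            ≡⟨ plain-mass i (ℕP.≤-trans (ℕP.n≤1+n i) si≤k) ⟩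
        G                                                 ∎
      where
      open ≡-Reasoning
      rearrange : ∀ a b c → a * (b * c) ≡ (c * a) * b
      rearrange = solve-∀

    plain-mass-coprime : d g k ≡ 1 → Plain.mass k ≡ G
    plain-mass-coprime dₖ≡1 = trans (sym (ℤP.*-identityˡ (Plain.mass k)))
                                    (trans (cong (λ z → + z * Plain.mass k) (sym dₖ≡1)) (plain-mass k ℕP.≤-refl))

    alt-twiceMean : ∀ i → Alt.twiceMean i ≡ Plain.twiceMean i
    alt-twiceMean zero    = refl
    alt-twiceMean (suc i) = cong (_+ plainU (suc i)) (alt-twiceMean i)

    evenCorrection : ℕ → ℤ
    evenCorrection l = (if does (2 ∣? g l) then 1ℤ else 0ℤ) * plainV l

    EvenCorrection : ℕ → ℤ
    EvenCorrection zero    = 0ℤ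
    EvenCorrection (suc i) = EvenCorrection i + evenCorrection (suc i)

    altV≡ : ∀ l → altV l ≡ + 3 * plainV l - + 2 * evenCorrection l
    altV≡ l = by-parity (2 ∣? g l) (plainV l)
      where
      by-parity : (dec : Dec (2 ∣ g l)) → ∀ x → (if does dec then 1ℤ else + 3) * x ≡ + 3 * x - + 2 * ((if does dec then 1ℤ else 0ℤ) * x)
      by-parity (yes _) = even-case
        where
        even-case : ∀ x → 1ℤ * x ≡ + 3 * x - + 2 * (1ℤ * x)
        even-case = solve-∀
      by-parity (no _) = odd-case
        where
        odd-case : ∀ x → + 3 * x ≡ + 3 * x - + 2 * (0ℤ * x)
        odd-case = solve-∀

    alt-twelveVariance : ∀ i → Alt.twelveVariance i ≡ + 3 * Plain.twelveVariance i - + 2 * EvenCorrection i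
    alt-twelveVariance zero    = refl
    alt-twelveVariance (suc i) = trans (cong₂ _+_ (alt-twelveVariance i) (altV≡ (suc i)))
                                       (collect (Plain.twelveVariance i) (EvenCorrection i) (plainV (suc i)) (evenCorrection (suc i)))
      where
      collect : ∀ a b c e → (+ 3 * a - + 2 * b) + (+ 3 * c - + 2 * e) ≡ + 3 * (a + c) - + 2 * (b + e)
      collect = solve-∀

    module AllOddSequence (all-odd : ∀ i → i ≤ k → ¬ (2 ∣ g i)) where
      odd-position : ∀ l → l ≤ k → (dec : Dec (2 ∣ g l)) → (if does dec then 1ℤ else 0ℤ) ≡ 0ℤ × (if does dec then c g l else 1) ≡ 1
      odd-position l l≤k (yes even) = ⊥-elim (all-odd l l≤k even)
      odd-position l l≤k (no _)     = refl , refl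

      alt-mass≡1 : ∀ i → i ≤ k → Alt.mass i ≡ 1ℤ
      alt-mass≡1 zero    _    = refl
      alt-mass≡1 (suc i) si≤k = cong₂ _*_ (alt-mass≡1 i (ℕP.≤-trans (ℕP.n≤1+n i) si≤k))
                                          (cong +_ (proj₂ (odd-position (suc i) si≤k (2 ∣? g (suc i)))))

      correction≡0 : ∀ i → i ≤ k → EvenCorrection i ≡ 0ℤ
      correction≡0 zero    _    = refl
      correction≡0 (suc i) si≤k = cong₂ _+_ (correction≡0 i (ℕP.≤-trans (ℕP.n≤1+n i) si≤k))
        (trans (cong (_* plainV (suc i)) (proj₁ (odd-position (suc i) si≤k (2 ∣? g (suc i))))) (ℤP.*-zeroˡ (plainV (suc i))))

    s t : ℕ → ℤ
    s r = listSum NR (λ n → power r (+ n))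
    t r = listSum NR (λ n → sign n * power r (+ n))

    linear-telescoping : ∀ (f : ℕ → ℤ) m (K : ℕ → ℤ) (F : ℕ → ℕ → ℤ) →
      (∀ n → f (n ℕ.+ g₀) - f n ≡ sumℤ m (λ r → K r * F r n)) →
      sumℤ m (λ r → K r * listSum NR (F r)) ≡ digitSum (c g) g k f - sumℤ g₀ f
    linear-telescoping f m K F pointwise =
      trans (sym (listSum-linear NR m K F)) (trans (sym (listSum-ext NR pointwise)) (telescoping f))

    plain-equation : ∀ j → 1 ≤ j → j ≤ 3 → plainDifference j G s ≡ Plain.moment k j - sumℤ g₀ (λ r → 1ℤ * power j (+ r))
    plain-equation j 1≤j j≤3 = linear-telescoping (λ n → 1ℤ * power j (+ n)) j (λ r → binom j r * power (j ℕ.∸ r) G) (λ r n → power r (+ n))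
      (λ n → trans (cong (λ z → 1ℤ * power j z - 1ℤ * power j (+ n)) (ℤP.pos-+ n g₀)) (plainDifference-pointwise j 1≤j j≤3 (+ n) G))

    plain-initial : ∀ j → sumℤ g₀ (λ r → 1ℤ * power j (+ r)) ≡ progressionSum 1 j g₀
    plain-initial j = sumℤ-ext g₀ (λ a → cong (λ z → 1ℤ * power j (+ z)) (sym (ℕP.*-identityʳ a)))

    U V : ℤ
    U = Plain.twiceMean k
    V = Plain.twelveVariance k

    module PlainEquations (dₖ≡1 : d g k ≡ 1) where

      e-s0 : + 2 * s 0 ≡ U - G + 1ℤ
      e-s0 = plain-degree-1 G s _ _ U (plain-equation 1 (s≤s z≤n) (s≤s z≤n))
               (trans (Profile.moment₁ plainProfile) (cong (_* U) (plain-mass-coprime dₖ≡1)))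
               (trans (cong (+ 2 *_) (plain-initial 1)) (Profile.moment₁ (progression-profile 1 g₀)))

      e-s1 : + 96 * s 1 + + 48 * G * s 0 ≡ + 12 * (U * U) + + 4 * V - (+ 12 * ((G - 1ℤ) * (G - 1ℤ)) + + 4 * (G * G - 1ℤ))
      e-s1 = plain-degree-2 G s _ _ U V (plain-equation 2 (s≤s z≤n) (s≤s (s≤s z≤n)))
               (trans (Profile.moment₂ plainProfile) (cong (_* (+ 12 * (U * U) + + 4 * V)) (plain-mass-coprime dₖ≡1)))
               (trans (cong (+ 48 *_) (plain-initial 2)) (Profile.moment₂ (progression-profile 1 g₀)))

      e-s2 : + 24 * s 2 + + 24 * G * s 1 + + 8 * G * G * s 0 ≡ U * U * U + U * V - ((G - 1ℤ) * (G - 1ℤ) * (G - 1ℤ) + (G - 1ℤ) * (G * G - 1ℤ))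
      e-s2 = plain-degree-3 G s _ _ U V (plain-equation 3 (s≤s z≤n) (s≤s (s≤s (s≤s z≤n))))
               (trans (Profile.moment₃ plainProfile) (cong (_* (U * U * U + U * V)) (plain-mass-coprime dₖ≡1)))
               (trans (cong (+ 8 *_) (plain-initial 3)) (Profile.moment₃ (progression-profile 1 g₀)))

    module AltEquations (g₀-odd : ¬ (2 ∣ g 0)) where
      t₀ = proj₁ (odd⇒double+1 g₀ g₀-odd)
      g₀≡ = proj₂ (odd⇒double+1 g₀ g₀-odd)

      P E : ℤ
      P = Alt.mass k
      E = EvenCorrection k

      sign-shift : ∀ n → sign (n ℕ.+ g₀) ≡ sign n * -1ℤ
      sign-shift n = trans (sign-+ n g₀) (cong (sign n *_) (trans (cong sign g₀≡) (cong (-1ℤ *_) (sign-even t₀))))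

      alt-equation : ∀ j → j ≤ 2 → altDifference j G t ≡ Alt.moment k j - sumℤ g₀ (λ r → sign r * power j (+ r))
      alt-equation j j≤2 = linear-telescoping (λ n → sign n * power j (+ n)) (suc j)
        (λ r → - (binom j r * power (j ℕ.∸ r) G + δ j r)) (λ r n → sign n * power r (+ n))
        (λ n → trans (cong₂ (λ σ z → σ * power j z - sign n * power j (+ n)) (sign-shift n) (ℤP.pos-+ n g₀))
                     (altDifference-pointwise j j≤2 (sign n) (+ n) G))

      alt-initial : ∀ j → sumℤ g₀ (λ r → sign r * power j (+ r)) ≡ altProgressionSum 1 j t₀
      alt-initial j = trans (cong (λ n → sumℤ n (λ r → sign r * power j (+ r))) g₀≡)
                            (sumℤ-ext (suc (t₀ ℕ.+ t₀)) (λ a → cong (λ z → sign a * power j z) (sym (ℤP.*-identityʳ (+ a)))))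

      oddLength≡G : oddLength 1 t₀ ≡ G
      oddLength≡G = trans (sym (oddLength≡ 1 t₀)) (cong +_ (sym g₀≡))

      initial-profile : Profile (λ r → altProgressionSum 1 r t₀) 1ℤ ((G - 1ℤ) * + 1) (+ 3 * ((G * G - 1ℤ) * (+ 1 * + 1)))
      initial-profile = subst (λ X → Profile (λ r → altProgressionSum 1 r t₀) 1ℤ ((X - 1ℤ) * + 1) (+ 3 * ((X * X - 1ℤ) * (+ 1 * + 1))))
                              oddLength≡G (altProgression-profile 1 t₀)

      e-t0 : + 2 * t 0 ≡ 1ℤ - P
      e-t0 = alt-degree-0 G t _ _ P (alt-equation 0 z≤n) (Profile.moment₀ (altProfile g₀-odd))
               (trans (alt-initial 0) (Profile.moment₀ initial-profile))

      e-t1 : + 4 * t 1 + + 2 * G * t 0 ≡ (G - 1ℤ) - P * U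
      e-t1 = alt-degree-1 G t _ _ P U (alt-equation 1 (s≤s z≤n))
               (trans (Profile.moment₁ (altProfile g₀-odd)) (cong (P *_) (alt-twiceMean k)))
               (trans (cong (+ 2 *_) (alt-initial 1)) (Profile.moment₁ initial-profile))

      e-t2 : + 96 * t 2 + + 96 * G * t 1 + + 48 * G * G * t 0 ≡
             + 12 * ((G - 1ℤ) * (G - 1ℤ)) + + 12 * (G * G - 1ℤ) - P * (+ 12 * (U * U) + + 4 * (+ 3 * V - + 2 * E))
      e-t2 = alt-degree-2 G t _ _ P U (+ 3 * V - + 2 * E) (alt-equation 2 (s≤s (s≤s z≤n)))
               (trans (Profile.moment₂ (altProfile g₀-odd))
                      (cong₂ (λ u w → P * (+ 12 * (u * u) + + 4 * w)) (alt-twiceMean k) (alt-twelveVariance k)))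
               (trans (cong (+ 48 *_) (alt-initial 2)) (Profile.moment₂ initial-profile))

module RationalEmbedding where
  open import Defs
  open Telescoping using (listSum)
  open import Data.Nat as ℕ using (ℕ; zero; suc)
  import Data.Nat.Properties as ℕP
  open import Data.Integer as ℤ using (ℤ; +_; 0ℤ; 1ℤ)
  import Data.Integer.Properties as ℤP
  open import Data.Integer.Tactic.RingSolver using (solve-∀)
  open import Data.Rational as ℚ using (ℚ; 0ℚ; 1ℚ; _+_; _*_; _-_; -_; toℚᵘ; 1/_)
  open import Data.Rational.Properties as ℚP using (toℚᵘ-injective; toℚᵘ-fromℚᵘ; toℚᵘ-homo-+; toℚᵘ-homo-*; toℚᵘ-homo‿-)
  import Data.Rational.Unnormalised as ℚᵘ
  import Data.Rational.Unnormalised.Properties as ℚᵘP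
  open import Relation.Binary.PropositionalEquality
  open import Data.List using ([]; _∷_; map)

  φ : ℤ → ℚ
  φ = toℚ

  φ≃ : ∀ z → toℚᵘ (φ z) ℚᵘ.≃ ℚᵘ.mkℚᵘ z 0
  φ≃ z = toℚᵘ-fromℚᵘ (ℚᵘ.mkℚᵘ z 0)

  φ-+ : ∀ a b → φ (a ℤ.+ b) ≡ φ a + φ b
  φ-+ a b = toℚᵘ-injective (ℚᵘP.≃-trans (φ≃ (a ℤ.+ b)) (ℚᵘP.≃-sym
              (ℚᵘP.≃-trans (toℚᵘ-homo-+ (φ a) (φ b)) (ℚᵘP.≃-trans (ℚᵘP.+-cong (φ≃ a) (φ≃ b)) (ℚᵘ.*≡* (cross a b))))))
    where
    cross : ∀ a b → (a ℤ.* + 1 ℤ.+ b ℤ.* + 1) ℤ.* + 1 ≡ (a ℤ.+ b) ℤ.* + 1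
    cross = solve-∀

  φ-* : ∀ a b → φ (a ℤ.* b) ≡ φ a * φ b
  φ-* a b = toℚᵘ-injective (ℚᵘP.≃-trans (φ≃ (a ℤ.* b)) (ℚᵘP.≃-sym
              (ℚᵘP.≃-trans (toℚᵘ-homo-* (φ a) (φ b)) (ℚᵘP.≃-trans (ℚᵘP.*-cong (φ≃ a) (φ≃ b)) (ℚᵘ.*≡* refl)))))

  φ-neg : ∀ a → φ (ℤ.- a) ≡ - φ a
  φ-neg a = toℚᵘ-injective (ℚᵘP.≃-trans (φ≃ (ℤ.- a)) (ℚᵘP.≃-sym
              (ℚᵘP.≃-trans (toℚᵘ-homo‿- (φ a)) (ℚᵘP.≃-trans (ℚᵘP.-‿cong (φ≃ a)) (ℚᵘ.*≡* refl)))))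

  φ-- : ∀ a b → φ (a ℤ.- b) ≡ φ a - φ b
  φ-- a b = trans (φ-+ a (ℤ.- b)) (cong (_+_ (φ a)) (φ-neg b))

  φ-injective : ∀ a b → φ a ≡ φ b → a ≡ b
  φ-injective a b e with ℚᵘP.≃-trans (ℚᵘP.≃-sym (φ≃ a)) (ℚᵘP.≃-trans (ℚᵘP.≃-reflexive (cong toℚᵘ e)) (φ≃ b))
  ... | ℚᵘ.*≡* eq = trans (sym (ℤP.*-identityʳ a)) (trans eq (ℤP.*-identityʳ b))

  sumℚ-φ : ∀ xs (F : ℕ → ℚ) (h : ℕ → ℤ) → (∀ n → F n ≡ φ (h n)) → sumℚ (map F xs) ≡ φ (listSum xs h)
  sumℚ-φ []       F h e = refl
  sumℚ-φ (x ∷ xs) F h e = trans (cong₂ _+_ (e x) (sumℚ-φ xs F h e)) (sym (φ-+ (h x) _))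

  cancelℚ : ∀ (K x y : ℚ) → K ≢ 0ℚ → K * x ≡ K * y → x ≡ y
  cancelℚ K x y K≢0 e = begin
      x                   ≡⟨ sym (ℚP.*-identityˡ x) ⟩
      1ℚ * x              ≡⟨ cong (_* x) (sym (ℚP.*-inverseˡ K)) ⟩
      (1/ K) * K * x      ≡⟨ ℚP.*-assoc (1/ K) K x ⟩
      (1/ K) * (K * x)    ≡⟨ cong ((1/ K) *_) e ⟩
      (1/ K) * (K * y)    ≡⟨ sym (ℚP.*-assoc (1/ K) K y) ⟩
      (1/ K) * K * y      ≡⟨ cong (_* y) (ℚP.*-inverseˡ K) ⟩
      1ℚ * y              ≡⟨ ℚP.*-identityˡ y ⟩
      y                   ∎
    where
    open ≡-Reasoning
    instance
      K-nonZero : ℚ.NonZero K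
      K-nonZero = ℚ.≢-nonZero K≢0

  2L-1≡ : ∀ t → + 2 ℤ.* + suc t ℤ.- 1ℤ ≡ + suc (2 ℕ.* t)
  2L-1≡ t = trans (cong (λ z → + 2 ℤ.* z ℤ.- 1ℤ) (ℤP.pos-+ 1 t))
              (trans (collect (+ t)) (sym (trans (ℤP.pos-+ 1 (2 ℕ.* t)) (cong (ℤ._+_ 1ℤ) (ℤP.pos-* 2 t)))))
    where
    collect : ∀ T → + 2 ℤ.* (1ℤ ℤ.+ T) ℤ.- 1ℤ ≡ 1ℤ ℤ.+ + 2 ℤ.* T
    collect = solve-∀

  divOdd-* : ∀ L (x : ℤ) → divOdd x L * φ (+ 2 ℤ.* + L ℤ.- 1ℤ) ≡ φ x
  divOdd-* zero    x = trans (cong (_* φ (+ 2 ℤ.* + 0 ℤ.- 1ℤ)) (sym (φ-neg x))) (trans (sym (φ-* (ℤ.- x) _)) (cong φ (negate x)))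
    where
    negate : ∀ x → (ℤ.- x) ℤ.* (+ 2 ℤ.* + 0 ℤ.- 1ℤ) ≡ x
    negate = solve-∀
  divOdd-* (suc t) x = trans (cong (λ z → (x ℚ./ suc (2 ℕ.* t)) * φ z) (2L-1≡ t))
    (toℚᵘ-injective (ℚᵘP.≃-trans (toℚᵘ-homo-* (x ℚ./ suc (2 ℕ.* t)) (φ (+ suc (2 ℕ.* t))))
      (ℚᵘP.≃-trans (ℚᵘP.*-cong (toℚᵘ-fromℚᵘ (ℚᵘ.mkℚᵘ x (2 ℕ.* t))) (φ≃ (+ suc (2 ℕ.* t))))
        (ℚᵘP.≃-trans (ℚᵘ.*≡* (cross x (2 ℕ.* t))) (ℚᵘP.≃-sym (φ≃ x))))))
    where
    cross : ∀ x m → (x ℤ.* + suc m) ℤ.* + 1 ≡ x ℤ.* + (suc m ℕ.* 1)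
    cross x m = trans (ℤP.*-identityʳ _) (cong (x ℤ.*_) (cong +_ (sym (ℕP.*-identityʳ (suc m)))))

  2L-1≢0 : ∀ L → φ (+ 2 ℤ.* + L ℤ.- 1ℤ) ≢ 0ℚ
  2L-1≢0 zero    e with φ-injective (+ 2 ℤ.* + 0 ℤ.- 1ℤ) 0ℤ e
  ... | ()
  2L-1≢0 (suc t) e with φ-injective (+ suc (2 ℕ.* t)) 0ℤ (trans (cong φ (sym (2L-1≡ t))) e)
  ... | ()

module RationalForms where
  open import Defs
  open RationalEmbedding
  open import Data.Integer as ℤ using (ℤ; +_; 1ℤ)
  open import Data.Rational using (0ℚ; 1ℚ; _+_; _*_; _-_; -_; ½; _/_)
  open import Data.Rational.Solver using (module +-*-Solver)
  open import Relation.Binary.PropositionalEquality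
  open +-*-Solver
  open ≡-Reasoning

  φ-2s-1 : ∀ s → φ (+ 2 ℤ.* s ℤ.- 1ℤ) ≡ ofℕ 2 * φ s - 1ℚ
  φ-2s-1 s = trans (φ-- (+ 2 ℤ.* s) 1ℤ) (cong (_- 1ℚ) (φ-* (+ 2) s))

  T₀-form : ∀ t0 P → + 2 ℤ.* t0 ≡ 1ℤ ℤ.- P → φ t0 ≡ ½ * (1ℚ - φ P)
  T₀-form t0 P h = begin
      φ t0                   ≡⟨ solve 1 (λ t → t := con ½ :* (con (ofℕ 2) :* t)) refl (φ t0) ⟩
      ½ * (ofℕ 2 * φ t0)     ≡⟨ cong (½ *_) (sym (φ-* (+ 2) t0)) ⟩
      ½ * φ (+ 2 ℤ.* t0)     ≡⟨ cong (λ z → ½ * φ z) h ⟩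
      ½ * φ (1ℤ ℤ.- P)       ≡⟨ cong (½ *_) (φ-- 1ℤ P) ⟩
      ½ * (1ℚ - φ P)         ∎

  T₁-form : ∀ t1 s0 P → + 4 ℤ.* t1 ≡ ℤ.- (1ℤ ℤ.+ (+ 2 ℤ.* s0 ℤ.- 1ℤ) ℤ.* P) →
            φ t1 ≡ - ((+ 1 / 4) * (1ℚ + (ofℕ 2 * φ s0 - 1ℚ) * φ P))
  T₁-form t1 s0 P h = begin
      φ t1                                              ≡⟨ solve 1 (λ t → t := con (+ 1 / 4) :* (con (ofℕ 4) :* t)) refl (φ t1) ⟩
      (+ 1 / 4) * (ofℕ 4 * φ t1)                        ≡⟨ cong ((+ 1 / 4) *_) (trans (sym (φ-* (+ 4) t1)) (cong φ h)) ⟩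
      (+ 1 / 4) * φ (ℤ.- (1ℤ ℤ.+ (+ 2 ℤ.* s0 ℤ.- 1ℤ) ℤ.* P))
        ≡⟨ cong ((+ 1 / 4) *_) (trans (φ-neg (1ℤ ℤ.+ A ℤ.* P)) (cong -_ (trans (φ-+ 1ℤ (A ℤ.* P)) (cong (_+_ 1ℚ) (trans (φ-* A P) (cong (_* φ P) (φ-2s-1 s0))))))) ⟩
      (+ 1 / 4) * (- (1ℚ + (ofℕ 2 * φ s0 - 1ℚ) * φ P))
        ≡⟨ solve 2 (λ s p → con (+ 1 / 4) :* (:- (con 1ℚ :+ (con (ofℕ 2) :* s :- con 1ℚ) :* p))
                            := :- (con (+ 1 / 4) :* (con 1ℚ :+ (con (ofℕ 2) :* s :- con 1ℚ) :* p))) refl (φ s0) (φ P) ⟩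
      - ((+ 1 / 4) * (1ℚ + (ofℕ 2 * φ s0 - 1ℚ) * φ P))  ∎
    where A = + 2 ℤ.* s0 ℤ.- 1ℤ

  -- θ stands for 3 S₂ / (2 S₀ − 1); division by the nonzero 2 S₀ − 1 is undone by cancelℚ.
  T₂-form : ∀ t2 s0 s2 E P θ → + 12 ℤ.* (+ 2 ℤ.* s0 ℤ.- 1ℤ) ℤ.* t2 ≡ ℤ.- ((+ 36 ℤ.* s2 ℤ.- (+ 2 ℤ.* s0 ℤ.- 1ℤ) ℤ.* E) ℤ.* P) →
            θ * (ofℕ 2 * φ s0 - 1ℚ) ≡ ofℕ 3 * φ s2 → ofℕ 2 * φ s0 - 1ℚ ≢ 0ℚ →
            φ t2 ≡ - ((θ - (+ 1 / 12) * φ E) * φ P)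
  T₂-form t2 s0 s2 E P θ h hθ nz = cancelℚ D _ _ nz (begin
      D * φ t2
        ≡⟨ solve 2 (λ t d → d :* t := con (+ 1 / 12) :* (con (ofℕ 12) :* d :* t)) refl (φ t2) D ⟩
      (+ 1 / 12) * (ofℕ 12 * D * φ t2)
        ≡⟨ cong (λ z → (+ 1 / 12) * (z * φ t2)) (trans (cong (ofℕ 12 *_) (sym (φ-2s-1 s0))) (sym (φ-* (+ 12) A))) ⟩
      (+ 1 / 12) * (φ (+ 12 ℤ.* (+ 2 ℤ.* s0 ℤ.- 1ℤ)) * φ t2)
        ≡⟨ cong ((+ 1 / 12) *_) (trans (sym (φ-* (+ 12 ℤ.* A) t2)) (cong φ h)) ⟩
      (+ 1 / 12) * φ (ℤ.- ((+ 36 ℤ.* s2 ℤ.- (+ 2 ℤ.* s0 ℤ.- 1ℤ) ℤ.* E) ℤ.* P))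
        ≡⟨ cong ((+ 1 / 12) *_) pushed ⟩
      (+ 1 / 12) * (- ((ofℕ 36 * φ s2 - D * φ E) * φ P))
        ≡⟨ solve 4 (λ s2 d e p → con (+ 1 / 12) :* (:- ((con (ofℕ 36) :* s2 :- d :* e) :* p))
                                 := :- ((con (ofℕ 3) :* s2 :- con (+ 1 / 12) :* e :* d) :* p)) refl (φ s2) D (φ E) (φ P) ⟩
      - ((ofℕ 3 * φ s2 - (+ 1 / 12) * φ E * D) * φ P)
        ≡⟨ cong (λ z → - ((z - (+ 1 / 12) * φ E * D) * φ P)) (sym hθ) ⟩
      - ((θ * D - (+ 1 / 12) * φ E * D) * φ P)
        ≡⟨ solve 4 (λ d e p θ → :- ((θ :* d :- con (+ 1 / 12) :* e :* d) :* p) := d :* (:- ((θ :- con (+ 1 / 12) :* e) :* p))) refl D (φ E) (φ P) θ ⟩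
      D * (- ((θ - (+ 1 / 12) * φ E) * φ P)) ∎)
    where
    D = ofℕ 2 * φ s0 - 1ℚ
    A = + 2 ℤ.* s0 ℤ.- 1ℤ
    pushed : φ (ℤ.- ((+ 36 ℤ.* s2 ℤ.- (+ 2 ℤ.* s0 ℤ.- 1ℤ) ℤ.* E) ℤ.* P)) ≡ - ((ofℕ 36 * φ s2 - D * φ E) * φ P)
    pushed = trans (φ-neg ((+ 36 ℤ.* s2 ℤ.- A ℤ.* E) ℤ.* P)) (cong -_ (trans (φ-* (+ 36 ℤ.* s2 ℤ.- A ℤ.* E) P)
               (cong (_* φ P) (trans (φ-- (+ 36 ℤ.* s2) (A ℤ.* E))
                 (cong₂ _-_ (φ-* (+ 36) s2) (trans (φ-* A E) (cong (_* φ E) (φ-2s-1 s0))))))))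

  T₁-half-form : ∀ t1 s0 → + 2 ℤ.* t1 ≡ ℤ.- s0 → φ t1 ≡ - (½ * φ s0)
  T₁-half-form t1 s0 h = begin
      φ t1                 ≡⟨ solve 1 (λ t → t := con ½ :* (con (ofℕ 2) :* t)) refl (φ t1) ⟩
      ½ * (ofℕ 2 * φ t1)   ≡⟨ cong (½ *_) (trans (sym (φ-* (+ 2) t1)) (trans (cong φ h) (φ-neg s0))) ⟩
      ½ * (- φ s0)         ≡⟨ solve 1 (λ s → con ½ :* (:- s) := :- (con ½ :* s)) refl (φ s0) ⟩
      - (½ * φ s0)         ∎

  T₂-S₀-form : ∀ t2 s0 Z → + 8 ℤ.* t2 ≡ ℤ.- (+ 4 ℤ.* (s0 ℤ.* (s0 ℤ.- 1ℤ))) ℤ.- Z →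
               φ t2 ≡ - (½ * (φ s0 * (φ s0 - 1ℚ))) - (+ 1 / 4) * (½ * φ Z)
  T₂-S₀-form t2 s0 Z h = begin
      φ t2                        ≡⟨ solve 1 (λ t → t := con (+ 1 / 8) :* (con (ofℕ 8) :* t)) refl (φ t2) ⟩
      (+ 1 / 8) * (ofℕ 8 * φ t2)  ≡⟨ cong ((+ 1 / 8) *_) (trans (sym (φ-* (+ 8) t2)) (trans (cong φ h) pushed)) ⟩
      (+ 1 / 8) * (- (ofℕ 4 * (φ s0 * (φ s0 - 1ℚ))) - φ Z)
        ≡⟨ solve 2 (λ s z → con (+ 1 / 8) :* (:- (con (ofℕ 4) :* (s :* (s :- con 1ℚ))) :- z)
                            := :- (con ½ :* (s :* (s :- con 1ℚ))) :- con (+ 1 / 4) :* (con ½ :* z)) refl (φ s0) (φ Z) ⟩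
      - (½ * (φ s0 * (φ s0 - 1ℚ))) - (+ 1 / 4) * (½ * φ Z) ∎
    where
    pushed : φ (ℤ.- (+ 4 ℤ.* (s0 ℤ.* (s0 ℤ.- 1ℤ))) ℤ.- Z) ≡ - (ofℕ 4 * (φ s0 * (φ s0 - 1ℚ))) - φ Z
    pushed = trans (φ-- (ℤ.- (+ 4 ℤ.* (s0 ℤ.* (s0 ℤ.- 1ℤ)))) Z) (cong (_- φ Z) (trans (φ-neg (+ 4 ℤ.* (s0 ℤ.* (s0 ℤ.- 1ℤ))))
               (cong -_ (trans (φ-* (+ 4) (s0 ℤ.* (s0 ℤ.- 1ℤ))) (cong (ofℕ 4 *_) (trans (φ-* s0 (s0 ℤ.- 1ℤ)) (cong (φ s0 *_) (φ-- s0 1ℤ))))))))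

  T₂-S₂-form : ∀ t2 s0 s2 θ → (+ 2 ℤ.* s0 ℤ.- 1ℤ) ℤ.* t2 ≡ ℤ.- (+ 3 ℤ.* s2) →
               θ * (ofℕ 2 * φ s0 - 1ℚ) ≡ ofℕ 3 * φ s2 → ofℕ 2 * φ s0 - 1ℚ ≢ 0ℚ → φ t2 ≡ - θ
  T₂-S₂-form t2 s0 s2 θ h hθ nz = cancelℚ D _ _ nz (begin
      D * φ t2                 ≡⟨ cong (_* φ t2) (sym (φ-2s-1 s0)) ⟩
      φ (+ 2 ℤ.* s0 ℤ.- 1ℤ) * φ t2 ≡⟨ trans (sym (φ-* (+ 2 ℤ.* s0 ℤ.- 1ℤ) t2)) (cong φ h) ⟩
      φ (ℤ.- (+ 3 ℤ.* s2))     ≡⟨ trans (φ-neg (+ 3 ℤ.* s2)) (cong -_ (φ-* (+ 3) s2)) ⟩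
      - (ofℕ 3 * φ s2)         ≡⟨ cong -_ (sym hθ) ⟩
      - (θ * D)                ≡⟨ solve 2 (λ d θ → :- (θ :* d) := d :* (:- θ)) refl D θ ⟩
      D * (- θ)                ∎)
    where D = ofℕ 2 * φ s0 - 1ℚ

  T₂-T₁-form : ∀ t2 t1 Z → + 8 ℤ.* t2 ≡ ℤ.- (+ 16 ℤ.* (t1 ℤ.* t1)) ℤ.- + 8 ℤ.* t1 ℤ.- Z →
               φ t2 ≡ - (ofℕ 2 * (φ t1 * φ t1)) - φ t1 - (+ 1 / 4) * (½ * φ Z)
  T₂-T₁-form t2 t1 Z h = begin
      φ t2                        ≡⟨ solve 1 (λ t → t := con (+ 1 / 8) :* (con (ofℕ 8) :* t)) refl (φ t2) ⟩
      (+ 1 / 8) * (ofℕ 8 * φ t2)  ≡⟨ cong ((+ 1 / 8) *_) (trans (sym (φ-* (+ 8) t2)) (trans (cong φ h) pushed)) ⟩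
      (+ 1 / 8) * (- (ofℕ 16 * (φ t1 * φ t1)) - ofℕ 8 * φ t1 - φ Z)
        ≡⟨ solve 2 (λ t z → con (+ 1 / 8) :* (:- (con (ofℕ 16) :* (t :* t)) :- con (ofℕ 8) :* t :- z)
                            := :- (con (ofℕ 2) :* (t :* t)) :- t :- con (+ 1 / 4) :* (con ½ :* z)) refl (φ t1) (φ Z) ⟩
      - (ofℕ 2 * (φ t1 * φ t1)) - φ t1 - (+ 1 / 4) * (½ * φ Z) ∎
    where
    pushed : φ (ℤ.- (+ 16 ℤ.* (t1 ℤ.* t1)) ℤ.- + 8 ℤ.* t1 ℤ.- Z) ≡ - (ofℕ 16 * (φ t1 * φ t1)) - ofℕ 8 * φ t1 - φ Z
    pushed = trans (φ-- (ℤ.- (+ 16 ℤ.* (t1 ℤ.* t1)) ℤ.- + 8 ℤ.* t1) Z) (cong (_- φ Z) (trans (φ-- (ℤ.- (+ 16 ℤ.* (t1 ℤ.* t1))) (+ 8 ℤ.* t1)) (cong₂ _-_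
               (trans (φ-neg (+ 16 ℤ.* (t1 ℤ.* t1))) (cong -_ (trans (φ-* (+ 16) (t1 ℤ.* t1)) (cong (ofℕ 16 *_) (φ-* t1 t1)))))
               (φ-* (+ 8) t1))))

module Translation where
  open import Defs
  open FiniteSums
  open Telescoping using (listSum)
  open DigitMoments using (power)
  open ProgressionSums using (sign)
  open RationalEmbedding
  open import Data.Nat as ℕ using (ℕ; zero; suc; _≤_; _<_)
  import Data.Nat.Properties as ℕP
  open import Data.Nat.Divisibility using (_∣_; _∣?_)
  open import Data.Nat.ListAction using (sum; product)
  open import Data.Nat.ListAction.Properties using (product-++)
  open import Data.Integer as ℤ using (ℤ; +_; 0ℤ; 1ℤ)
  import Data.Integer.Properties as ℤP
  open import Data.Rational using (0ℚ; 1ℚ; _+_; _*_; _-_; ½)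
  open import Data.List using (List; []; _∷_; [_]; _++_; map; upTo; applyUpTo; length)
  open import Data.List.Properties using (map-++; upTo-∷ʳ)
  open import Data.Bool using (if_then_else_)
  open import Relation.Nullary using (yes; no; Dec; does)
  open import Relation.Binary.PropositionalEquality hiding ([_])

  listSum-applyUpTo : ∀ (f : ℕ → ℕ) n (h : ℕ → ℤ) → listSum (applyUpTo f n) h ≡ sumℤ n (λ i → h (f i))
  listSum-applyUpTo f zero    h = refl
  listSum-applyUpTo f (suc n) h = cong (ℤ._+_ (h (f 0))) (listSum-applyUpTo (λ i → f (suc i)) n h)

  product-last : ∀ (f : ℕ → ℕ) n → product (map f (upTo (suc n))) ≡ product (map f (upTo n)) ℕ.* f n
  product-last f n = begin
    product (map f (upTo (suc n)))            ≡⟨ cong (λ xs → product (map f xs)) (sym (upTo-∷ʳ n)) ⟩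
    product (map f (upTo n ++ [ n ]))         ≡⟨ cong product (map-++ f (upTo n) [ n ]) ⟩
    product (map f (upTo n) ++ [ f n ])       ≡⟨ product-++ (map f (upTo n)) [ f n ] ⟩
    product (map f (upTo n)) ℕ.* (f n ℕ.* 1)  ≡⟨ cong (product (map f (upTo n)) ℕ.*_) (ℕP.*-identityʳ (f n)) ⟩
    product (map f (upTo n)) ℕ.* f n          ∎
    where open ≡-Reasoning

  listSum-length : ∀ xs → listSum xs (λ _ → 1ℤ) ≡ + length xs
  listSum-length []       = refl
  listSum-length (x ∷ xs) = trans (cong (ℤ._+_ 1ℤ) (listSum-length xs)) (sym (ℤP.pos-+ 1 (length xs)))

  listSum-squares : ∀ xs → + sum (map (λ n → n ℕ.^ 2) xs) ≡ listSum xs (λ n → + n ℤ.* + n)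
  listSum-squares []       = refl
  listSum-squares (x ∷ xs) = trans (ℤP.pos-+ (x ℕ.^ 2) _)
    (cong₂ ℤ._+_ (trans (cong +_ (cong (x ℕ.*_) (ℕP.*-identityʳ x))) (ℤP.pos-* x x)) (listSum-squares xs))

  module Images (g : ℕ → ℕ) (k : ℕ) (pos : ∀ i → i ≤ k → 0 < g i) (sm : Smooth k g) (NR : List ℕ) (isNR : IsNR k g NR) where
    open Assembly.ForSequence g k pos sm NR isNR

    T≡ : ∀ m → m ≤ 2 → T NR m ≡ φ (t m)
    T≡ 0 _ = sumℚ-φ NR _ _ (λ n → refl)
    T≡ 1 _ = sumℚ-φ NR _ _ (λ n → cong (λ z → φ (sign n ℤ.* + z)) (ℕP.*-identityʳ n))
    T≡ 2 _ = sumℚ-φ NR _ _ (λ n → cong (λ z → φ (sign n ℤ.* z)) (trans (cong (λ w → + (n ℕ.* w)) (ℕP.*-identityʳ n)) (ℤP.pos-* n n)))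
    T≡ (suc (suc (suc m))) (ℕ.s≤s (ℕ.s≤s ()))

    S₀≡ : S NR 0 ≡ φ (s 0)
    S₀≡ = sumℚ-φ NR _ _ (λ n → refl)

    evenFactor : ℕ → ℕ
    evenFactor i = if does (2 ∣? g i) then c g i else 1

    evenFactor-0 : evenFactor 0 ≡ 1
    evenFactor-0 = c₀≡1 (2 ∣? g 0)
      where
      c₀≡1 : (dec : Dec (2 ∣ g 0)) → (if does dec then 1 else 1) ≡ 1
      c₀≡1 (yes _) = refl
      c₀≡1 (no _)  = refl

    evenFactor-product : ∀ i → + product (map evenFactor (upTo (suc i))) ≡ Alt.mass i
    evenFactor-product zero    = cong +_ (trans (ℕP.*-identityʳ (evenFactor 0)) evenFactor-0)
    evenFactor-product (suc i) = trans (cong +_ (product-last evenFactor (suc i)))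
      (trans (ℤP.pos-* (product (map evenFactor (upTo (suc i)))) (evenFactor (suc i))) (cong (ℤ._* altMass (suc i)) (evenFactor-product i)))

    prodIG≡ : prodIG k g ≡ φ (Alt.mass k)
    prodIG≡ = cong φ (evenFactor-product k)

    -- Σ_{i ∈ I_G} gᵢ²(cᵢ² − 1) is the total even correction (position 0 contributes 0 as c₀ = 1).
    plainV≡ : ∀ i → plainV i ≡ + (g i ℕ.* g i) ℤ.* (+ (c g i ℕ.* c g i) ℤ.- 1ℤ)
    plainV≡ i = trans (cong₂ (λ a b → (a ℤ.- 1ℤ) ℤ.* b) (sym (ℤP.pos-* (c g i) (c g i))) (sym (ℤP.pos-* (g i) (g i))))
                      (ℤP.*-comm (+ (c g i ℕ.* c g i) ℤ.- 1ℤ) (+ (g i ℕ.* g i)))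

    evenCorrection≡ : ∀ i → (if does (2 ∣? g i) then ofℕ (g i ℕ.* g i) * (ofℕ (c g i ℕ.* c g i) - 1ℚ) else 0ℚ) ≡ φ (evenCorrection i)
    evenCorrection≡ i = by-parity (2 ∣? g i)
      where
      by-parity : (dec : Dec (2 ∣ g i)) → (if does dec then ofℕ (g i ℕ.* g i) * (ofℕ (c g i ℕ.* c g i) - 1ℚ) else 0ℚ)
                                            ≡ φ ((if does dec then 1ℤ else 0ℤ) ℤ.* plainV i)
      by-parity (yes _) = sym (trans (cong φ (trans (ℤP.*-identityˡ (plainV i)) (plainV≡ i)))
                                     (trans (φ-* (+ (g i ℕ.* g i)) _) (cong (ofℕ (g i ℕ.* g i) *_) (φ-- (+ (c g i ℕ.* c g i)) 1ℤ))))
      by-parity (no _)  = sym (cong φ (ℤP.*-zeroˡ (plainV i)))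

    evenCorrection-0 : evenCorrection 0 ≡ 0ℤ
    evenCorrection-0 = trans (cong ((if does (2 ∣? g 0) then 1ℤ else 0ℤ) ℤ.*_) (ℤP.*-zeroˡ (+ g 0 ℤ.* + g 0)))
                             (ℤP.*-zeroʳ (if does (2 ∣? g 0) then 1ℤ else 0ℤ))

    sum-evenCorrection : ∀ i → sumℤ (suc i) evenCorrection ≡ EvenCorrection i
    sum-evenCorrection zero    = trans (ℤP.+-identityʳ (evenCorrection 0)) evenCorrection-0
    sum-evenCorrection (suc i) = trans (sumℤ-last (suc i) evenCorrection) (cong (ℤ._+ evenCorrection (suc i)) (sum-evenCorrection i))

    sumIG≡ : sumIG k g ≡ φ (EvenCorrection k)
    sumIG≡ = trans (sumℚ-φ (upTo (suc k)) _ evenCorrection evenCorrection≡)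
                   (cong φ (trans (listSum-applyUpTo (λ x → x) (suc k) evenCorrection) (sum-evenCorrection k)))

    sum-plainV : ∀ i → sumℤ i (λ j → plainV (suc j)) ≡ Plain.twelveVariance i
    sum-plainV zero    = refl
    sum-plainV (suc i) = trans (sumℤ-last i (λ j → plainV (suc j))) (cong (ℤ._+ plainV (suc i)) (sum-plainV i))

    Qval≡ : Qval k g ≡ ½ * φ (1ℤ ℤ.- G ℤ.* G ℤ.+ Plain.twelveVariance k)
    Qval≡ = cong (½ *_) (sym (trans (φ-+ (1ℤ ℤ.- G ℤ.* G) _)
      (cong₂ _+_ (trans (φ-- 1ℤ (G ℤ.* G)) (cong (λ z → 1ℚ - φ z) (sym (ℤP.pos-* (g 0) (g 0)))))
                 (sym (trans (sumℚ-φ (upTo k) _ (λ j → plainV (suc j)) term)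
                             (cong φ (trans (listSum-applyUpTo (λ x → x) k (λ j → plainV (suc j))) (sum-plainV k))))))))
      where
      term : ∀ j → (ofℕ (c g (suc j) ℕ.* c g (suc j)) - 1ℚ) * ofℕ (g (suc j) ℕ.* g (suc j)) ≡ φ (plainV (suc j))
      term j = sym (trans (cong φ (trans (plainV≡ (suc j)) (ℤP.*-comm (+ (g (suc j) ℕ.* g (suc j))) _)))
                          (trans (φ-* (+ (c g (suc j) ℕ.* c g (suc j)) ℤ.- 1ℤ) _) (cong (_* ofℕ (g (suc j) ℕ.* g (suc j))) (φ-- (+ (c g (suc j) ℕ.* c g (suc j))) 1ℤ))))

    s₀≡length : s 0 ≡ + length NR
    s₀≡length = listSum-length NR

    2S₀-1≡ : φ (+ 2 ℤ.* + length NR ℤ.- 1ℤ) ≡ ofℕ 2 * φ (s 0) - 1ℚ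
    2S₀-1≡ = trans (cong (λ z → φ (+ 2 ℤ.* z ℤ.- 1ℤ)) (sym s₀≡length)) (trans (φ-- (+ 2 ℤ.* s 0) 1ℤ) (cong (_- 1ℚ) (φ-* (+ 2) (s 0))))

    threeS2over-* : threeS2over NR * (ofℕ 2 * φ (s 0) - 1ℚ) ≡ ofℕ 3 * φ (s 2)
    threeS2over-* = trans (cong (threeS2over NR *_) (sym 2S₀-1≡))
      (trans (divOdd-* (length NR) _)
        (trans (cong φ (trans (ℤP.pos-* 3 (sum (map (λ n → n ℕ.^ 2) NR))) (cong (+ 3 ℤ.*_) (listSum-squares NR))))
               (φ-* (+ 3) (s 2))))

    2S₀-1≢0 : ofℕ 2 * φ (s 0) - 1ℚ ≢ 0ℚ
    2S₀-1≢0 e = 2L-1≢0 (length NR) (trans 2S₀-1≡ e)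

open import Defs
open import Data.Nat using (ℕ; _<_; _≤_; z≤n; s≤s)
import Data.Nat.Properties as ℕP
open import Data.Nat.Divisibility using (_∣_)
open import Data.Integer as ℤ using (+_; 1ℤ)
open import Data.Rational using (_+_; _-_; _*_; -_; ½; 1ℚ; _/_)
open import Data.List using (List)
open import Data.Product using (_×_; _,_)
open import Relation.Nullary using (¬_)
open import Relation.Binary.PropositionalEquality using (_≡_; sym; trans; cong; cong₂)

module Corollary (g : ℕ → ℕ) (k : ℕ) (pos : ∀ i → i ≤ k → 0 < g i) (dₖ≡1 : d g k ≡ 1) (sm : Smooth k g)
                 (NR : List ℕ) (isNR : IsNR k g NR) where
  open Assembly.ForSequence g k pos sm NR isNR
  open Translation.Images g k pos sm NR isNR
  open PlainEquations dₖ≡1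
  open RationalEmbedding using (φ)
  open RationalForms

  module Equations (g₀-odd : ¬ (2 ∣ g 0)) where
    open AltEquations g₀-odd public
    open Elimination.Solve G U V E P (s 0) (s 1) (s 2) (t 0) (t 1) (t 2) e-s0 e-s1 e-s2 e-t0 e-t1 e-t2 public

  θ = threeS2over NR

  odd-g₀ : ¬ (2 ∣ g 0) →
      (T NR 0 ≡ ½ * (1ℚ - prodIG k g))
    × (T NR 1 ≡ - ((+ 1 / 4) * (1ℚ + (ofℕ 2 * S NR 0 - 1ℚ) * prodIG k g)))
    × (T NR 2 ≡ - ((θ - (+ 1 / 12) * sumIG k g) * prodIG k g))
  odd-g₀ g₀-odd =
      trans (T≡ 0 z≤n) (trans (T₀-form (t 0) P e-t0) (cong (λ z → ½ * (1ℚ - z)) (sym prodIG≡))) ,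
      trans (T≡ 1 (s≤s z≤n)) (trans (T₁-form (t 1) (s 0) P T₁-formula)
        (cong₂ (λ a b → - ((+ 1 / 4) * (1ℚ + (ofℕ 2 * a - 1ℚ) * b))) (sym S₀≡) (sym prodIG≡))) ,
      trans (T≡ 2 (s≤s (s≤s z≤n))) (trans (T₂-form (t 2) (s 0) (s 2) E P θ T₂-formula threeS2over-* 2S₀-1≢0)
        (cong₂ (λ a b → - ((θ - (+ 1 / 12) * a) * b)) (sym sumIG≡) (sym prodIG≡)))
    where open Equations g₀-odd

  all-odd : (∀ i → i ≤ k → ¬ (2 ∣ g i)) →
      (T NR 0 ≡ ofℕ 0)
    × (T NR 1 ≡ - (½ * S NR 0))
    × (T NR 2 ≡ - (½ * (S NR 0 * (S NR 0 - 1ℚ))) - (+ 1 / 4) * Qval k g)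
    × (T NR 2 ≡ - θ)
    × (T NR 2 ≡ - (ofℕ 2 * (T NR 1 * T NR 1)) - T NR 1 - (+ 1 / 4) * Qval k g)
  all-odd odd =
      trans (T≡ 0 z≤n) (cong φ T₀-zero) ,
      trans (T≡ 1 (s≤s z≤n)) (trans (T₁-half-form (t 1) (s 0) T₁-half-S₀) (cong (λ a → - (½ * a)) (sym S₀≡))) ,
      trans (T≡ 2 (s≤s (s≤s z≤n))) (trans (T₂-S₀-form (t 2) (s 0) Z T₂-via-S₀)
        (cong₂ (λ a b → - (½ * (a * (a - 1ℚ))) - (+ 1 / 4) * b) (sym S₀≡) (sym Qval≡))) ,
      trans (T≡ 2 (s≤s (s≤s z≤n))) (T₂-S₂-form (t 2) (s 0) (s 2) θ T₂-via-S₂ threeS2over-* 2S₀-1≢0) ,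
      trans (T≡ 2 (s≤s (s≤s z≤n))) (trans (T₂-T₁-form (t 2) (t 1) Z T₂-via-T₁)
        (cong₂ (λ a b → - (ofℕ 2 * (a * a)) - a - (+ 1 / 4) * b) (sym (T≡ 1 (s≤s z≤n))) (sym Qval≡)))
    where
    open Equations (odd 0 z≤n)
    open AllOdd (AllOddSequence.alt-mass≡1 odd k ℕP.≤-refl) (AllOddSequence.correction≡0 odd k ℕP.≤-refl)
    Z = 1ℤ ℤ.- G ℤ.* G ℤ.+ V

corollary4p11 : (k : ℕ) (g : ℕ → ℕ) → (∀ i → i ≤ k → 0 < g i) → d g k ≡ 1 → Smooth k g →
  (NR : List ℕ) → IsNR k g NR →
  ((¬ (2 ∣ g 0)) →
      (T NR 0 ≡ ½ * (1ℚ - prodIG k g))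
    × (T NR 1 ≡ - ((+ 1 / 4) * (1ℚ + (ofℕ 2 * S NR 0 - 1ℚ) * prodIG k g)))
    × (T NR 2 ≡ - ((threeS2over NR - (+ 1 / 12) * sumIG k g) * prodIG k g)))
  × ((∀ i → i ≤ k → ¬ (2 ∣ g i)) →
      (T NR 0 ≡ ofℕ 0)
    × (T NR 1 ≡ - (½ * S NR 0))
    × (T NR 2 ≡ - (½ * (S NR 0 * (S NR 0 - 1ℚ))) - (+ 1 / 4) * Qval k g)
    × (T NR 2 ≡ - threeS2over NR)
    × (T NR 2 ≡ - (ofℕ 2 * (T NR 1 * T NR 1)) - T NR 1 - (+ 1 / 4) * Qval k g))
corollary4p11 k g pos dₖ≡1 sm NR isNR = odd-g₀ , all-odd
  where open Corollary g k pos dₖ≡1 sm NR isNR
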